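{- Let $A\ge1$, $n\ge0$, $\rho\ge0$ be integers and let $P_j(z;q)=\sum_{t=0}^n p_{j,t}(q)z^t$ ($j=1,\dots,A$) be polynomials in $z$ of degree at most $n$ with coefficients $p_{j,t}(q)\in\mathbb{Q}(q)$. Define $$R(s;q)=\sum_{j=1}^A\sum_{t=0}^n\frac{q^t p_{j,t}(q)}{(1-sq^t)^j},\qquad \Pi(s;q)=(s;q)_{n+1}^A\,R(s;q)$$ (so $\Pi$ is a polynomial in $s$ of degree $<A(n+1)$). Then there exists a polynomial $P_0(z;q)$ of degree at most $n$ with coefficients in $\mathbb{Q}(q)$ such that $$P_0(z;q)+\sum_{j=1}^A P_j(z;q)\operatorname{Li}_j(1/z;q)=\mathcal{O}(z^{ -\rho-1})\quad\text{as } z\to\infty$$ if and only if $(sq^{ -\rho};q)_\rho=\prod_{i=1}^{\rho}(1-sq^{ -i})$ divides $\Pi(s;q)$.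
   Context: $q$ is a complex number with $0<|q|<1$, $q\notin\mathbb{R}_-$. $(\alpha;q)_m=(1-\alpha)(1-\alpha q)\cdots(1-\alpha q^{m-1})$, $(\alpha;q)_0=1$. $\operatorname{Li}_j(z;q)=\sum_{k\ge1}\frac{q^k}{(1-q^k)^j}z^k$, so $\operatorname{Li}_j(1/z;q)$ is a series in $1/z$ converging for $|z|>|q|$; the $\mathcal{O}(z^{ -\rho-1})$ condition means the resulting Laurent expansion in $z$ contains only powers $z^{ -k}$ with $k\ge\rho+1$. -}

module Defs where

open import Data.Nat using (ℕ; zero; suc; _∸_)
open import Data.Bool using (Bool; true; false; not; T; if_then_else_)
open import Data.Bool.Properties using (T?)
open import Data.Fin using (Fin; toℕ) renaming (zero to fzero; suc to fsuc)
open import Data.Fin.Properties using () renaming (_≟_ to _≟ᶠ_)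
open import Data.List using (List; []; _∷_; map)
open import Data.Bool.ListAction using (any)
open import Data.List.Relation.Unary.All using (All)
open import Data.Product using (Σ)
open import Data.Unit using (tt)
open import Data.Integer using (ℤ; +_; -[1+_]) renaming (_-_ to _-ℤ_)
open import Data.Rational using (ℚ; 0ℚ; 1ℚ) renaming (_+_ to _+ℚ_; _*_ to _*ℚ_; -_ to -ℚ_)
open import Data.Rational.Properties using () renaming (_≟_ to _≟ℚ_)
open import Relation.Nullary using (yes; no)
open import Relation.Nullary.Decidable using (⌊_⌋)
open import Relation.Binary.PropositionalEquality using (_≡_)

-- Dense-list polynomials over a carrier with ring operations.
-- [a₀, a₁, …] represents a₀ + a₁ X + …; equality is "difference has
-- all coefficients ≈ 0" (so trailing zeros are irrelevant).

module PolyOver {K : Set} (0# 1# : K) (_+_ _*_ : K → K → K) (-_ : K → K)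
                (_≈_ : K → K → Set) where

  Poly : Set
  Poly = List K

  _⊕_ : Poly → Poly → Poly
  []      ⊕ q       = q
  (a ∷ p) ⊕ []      = a ∷ p
  (a ∷ p) ⊕ (b ∷ q) = (a + b) ∷ (p ⊕ q)

  scale : K → Poly → Poly
  scale a = map (a *_)

  _⊗_ : Poly → Poly → Poly
  []      ⊗ q = []
  (a ∷ p) ⊗ q = scale a q ⊕ (0# ∷ (p ⊗ q))

  ⊖_ : Poly → Poly
  ⊖ p = map -_ p

  _⊝_ : Poly → Poly → Poly
  p ⊝ q = p ⊕ (⊖ q)

  IsZero : Poly → Set
  IsZero p = All (_≈ 0#) p

  _≋_ : Poly → Poly → Set
  p ≋ q = IsZero (p ⊝ q)

  _∣ₚ_ : Poly → Poly → Set
  d ∣ₚ p = Σ Poly (λ c → p ≋ (d ⊗ c))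

  one : Poly
  one = 1# ∷ []

  C : K → Poly
  C a = a ∷ []

  X : Poly
  X = 0# ∷ 1# ∷ []

  _^ₚ_ : Poly → ℕ → Poly
  p ^ₚ zero  = one
  p ^ₚ suc m = p ⊗ (p ^ₚ m)

  ∏ : ∀ {m} → (Fin m → Poly) → Poly
  ∏ {zero}  f = one
  ∏ {suc m} f = f fzero ⊗ ∏ (λ i → f (fsuc i))

  ∑ : ∀ {m} → (Fin m → Poly) → Poly
  ∑ {zero}  f = []
  ∑ {suc m} f = f fzero ⊕ ∑ (λ i → f (fsuc i))

module QP = PolyOver 0ℚ 1ℚ _+ℚ_ _*ℚ_ -ℚ_ _≡_
open QP using () renaming (_⊕_ to _⊕q_; _⊗_ to _⊗q_; ⊖_ to ⊖q_; _≋_ to _≋q_)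

nonzero? : List ℚ → Bool
nonzero? = any (λ c → not ⌊ c ≟ℚ 0ℚ ⌋)

record ℚ⟮q⟯ : Set where
  constructor frac
  field
    num   : List ℚ
    den   : List ℚ
    den≢0 : T (nonzero? den)
open ℚ⟮q⟯

0F : ℚ⟮q⟯
0F = frac [] (1ℚ ∷ []) tt

-- a/d; the fallback branch (d = 0) is never used by the operations below
-- on genuine elements of ℚ(q) except for inverting 0 (where 0⁻¹ := 0).
mkF : List ℚ → List ℚ → ℚ⟮q⟯
mkF a d with T? (nonzero? d)
... | yes p = frac a d p
... | no  _ = 0F

1F : ℚ⟮q⟯
1F = mkF (1ℚ ∷ []) (1ℚ ∷ [])

_+F_ : ℚ⟮q⟯ → ℚ⟮q⟯ → ℚ⟮q⟯
x +F y = mkF ((num x ⊗q den y) ⊕q (num y ⊗q den x)) (den x ⊗q den y)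

_*F_ : ℚ⟮q⟯ → ℚ⟮q⟯ → ℚ⟮q⟯
x *F y = mkF (num x ⊗q num y) (den x ⊗q den y)

-F_ : ℚ⟮q⟯ → ℚ⟮q⟯
-F x = mkF (⊖q num x) (den x)

invF : ℚ⟮q⟯ → ℚ⟮q⟯
invF x = mkF (den x) (num x)

_≈F_ : ℚ⟮q⟯ → ℚ⟮q⟯ → Set
x ≈F y = (num x ⊗q den y) ≋q (num y ⊗q den x)

qF : ℚ⟮q⟯
qF = mkF (0ℚ ∷ 1ℚ ∷ []) (1ℚ ∷ [])

_^F_ : ℚ⟮q⟯ → ℕ → ℚ⟮q⟯
x ^F zero  = 1F
x ^F suc m = x *F (x ^F m)

∑F : ∀ {m} → (Fin m → ℚ⟮q⟯) → ℚ⟮q⟯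
∑F {zero}  f = 0F
∑F {suc m} f = f fzero +F ∑F (λ i → f (fsuc i))

module SP = PolyOver 0F 1F _+F_ _*F_ -F_ _≈F_
open SP public using () renaming (Poly to Poly-s; _⊕_ to _⊕s_; _⊗_ to _⊗s_;
  _⊝_ to _⊝s_; _∣ₚ_ to _∣s_; one to one-s; C to Cs; X to S; _^ₚ_ to _^s_;
  ∏ to ∏s; ∑ to ∑s)

-- q-Pochhammer symbol (a s; q)_m = ∏_{i=0}^{m-1} (1 - a s q^i) as a polynomial in s
qPoch : ℚ⟮q⟯ → ℕ → Poly-s
qPoch a zero    = one-s
qPoch a (suc m) = qPoch a m ⊗s (one-s ⊝s (Cs (a *F (qF ^F m)) ⊗s S))

lin : ℕ → Poly-s
lin t = one-s ⊝s (Cs (qF ^F t) ⊗s S)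

-- Π(s;q) = (s;q)_{n+1}^A R(s;q), with the factor (1 - s q^t)^j cancelled
-- explicitly in each term:
--   (s;q)_{n+1}^A / (1 - s q^t)^j = ∏_{i=0}^{n} (1 - s q^i)^{A - [i = t] j}.
-- Index j : Fin A stands for j+1 ∈ {1,…,A}; t : Fin (suc n) for t ∈ {0,…,n}.
Πpoly : (A n : ℕ) → (Fin A → Fin (suc n) → ℚ⟮q⟯) → Poly-s
Πpoly A n p =
  ∑s (λ (j : Fin A) → ∑s (λ (t : Fin (suc n)) →
    Cs ((qF ^F toℕ t) *F p j t) ⊗s
    ∏s (λ (i : Fin (suc n)) →
      lin (toℕ i) ^s (if ⌊ i ≟ᶠ t ⌋ then A ∸ suc (toℕ j) else A))))

-- coefficient of z^{-k} in Li_j(1/z;q): q^k/(1-q^k)^j for k ≥ 1, else 0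
liCoeff : ℕ → ℤ → ℚ⟮q⟯
liCoeff j (+ suc k) = (qF ^F suc k) *F invF ((1F +F (-F (qF ^F suc k))) ^F j)
liCoeff j _         = 0F

coeffAt : ∀ {m} → (Fin m → ℚ⟮q⟯) → ℤ → ℚ⟮q⟯
coeffAt {zero}  f e               = 0F
coeffAt {suc m} f (+ zero)        = f fzero
coeffAt {suc m} f (+ suc t)       = coeffAt (λ i → f (fsuc i)) (+ t)
coeffAt {suc m} f -[1+ _ ]        = 0F

laurentCoeff : {A n : ℕ} → (Fin (suc n) → ℚ⟮q⟯) → (Fin A → Fin (suc n) → ℚ⟮q⟯)
             → ℤ → ℚ⟮q⟯
laurentCoeff {A} {n} p0 p e =
  coeffAt p0 e +F
  ∑F (λ (j : Fin A) → ∑F (λ (t : Fin (suc n)) →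
    p j t *F liCoeff (suc (toℕ j)) ((+ toℕ t) -ℤ e)))

{-# OPTIONS --safe #-}
module Submission where

open import Defs
open import Data.Nat using (ℕ; suc; _≤_)
open import Data.Fin using (Fin)
open import Data.Product using (Σ)
open import Data.Integer using (ℤ; +_) renaming (_≤_ to _≤ℤ_; -_ to -ℤ_)
open import Function.Bundles using (_⇔_)

-- The coefficient of z^(-k-1) in ∑_j P_j(z) Li_j(1/z; q) is ∑_{j,t} p_{j,t} q^(t+k+1) / (1 - q^(t+k+1))^j,
-- which is q^(k+1) R(q^(k+1)); the coefficients of z^0, …, z^n can be cancelled by P₀, and the series
-- Li_j(1/z; q) contribute no other nonnegative powers of z. Since (s;q)_{n+1} does not vanish at
-- s = q^(k+1), the condition O(z^(-ρ-1)) says exactly that Π vanishes at q, q², …, q^ρ. These are the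
-- roots of the linear factors 1 - q^(i-ρ) s of (s q^(-ρ); q)_ρ, pairwise distinct because q is not a
-- root of unity, so over a field this is equivalent to (s q^(-ρ); q)_ρ dividing Π.

open import Level using (0ℓ)
open import Algebra.Bundles using (CommutativeRing; Semiring)
open import Algebra.Solver.Ring.AlmostCommutativeRing using (fromCommutativeRing; _-Raw-AlmostCommutative⟶_)
import Algebra.Definitions.RawSemiring
import Algebra.Properties.Monoid.Sum
open import Data.Bool using (T; if_then_else_)
open import Data.Bool.Properties using (T?; T-irrelevant)
open import Data.Empty using (⊥-elim)
open import Data.Fin using (toℕ) renaming (zero to fzero; suc to fsuc)
open import Data.Fin.Properties using (toℕ<n) renaming (_≟_ to _≟ᶠ_)
open import Data.List using (List; []; _∷_)
open import Data.Maybe using (Maybe; just; nothing)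
open import Data.Nat using (zero; _∸_)
import Data.Nat as ℕ
import Data.Nat.Properties as ℕ
import Data.Integer as ℤ
import Data.Integer.Properties as ℤ
open import Data.Product using (_,_; proj₁; proj₂)
open import Data.Rational using (ℚ; 0ℚ; 1ℚ)
import Data.Rational as ℚ
import Data.Rational.Properties as ℚ
import Data.Sign as Sign
open import Data.Unit using (tt)
open import Function.Base using (_∘_)
open import Function.Bundles using (Equivalence; mk⇔)
open import Function.Construct.Composition using (_⇔-∘_)
open import Function.Construct.Symmetry using (⇔-sym)
open import Relation.Binary.PropositionalEquality as ≡ using (_≡_)
import Relation.Binary.Reasoning.Setoid
open import Relation.Nullary using (¬_; yes; no; Dec)
open import Relation.Nullary.Decidable using (⌊_⌋)

-- The library's ring solver needs coefficients with a decidable equality; ℤ maps into every ring.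
module CommutativeRingSolver (R : CommutativeRing 0ℓ 0ℓ) where
  open CommutativeRing R
  open import Algebra.Properties.Ring ring using (-‿involutive; -0#≈0#; -1*x≈-x)
  open import Algebra.Properties.AbelianGroup +-abelianGroup using (⁻¹-∙-comm)
  open import Algebra.Properties.Semiring.Mult semiring using (_×_; ×-homo-+; ×-congˡ; ×1-homo-*)
  open import Algebra.Properties.CommutativeSemigroup *-commutativeSemigroup using (interchange)
  open import Relation.Binary.Reasoning.Setoid setoid

  ℤ⟶R : ℤ → Carrier
  ℤ⟶R (+ n)      = n × 1#
  ℤ⟶R ℤ.-[1+ n ] = - (suc n × 1#)

  [1+a]-[1+b]≈a-b : ∀ a b → (1# + a) - (1# + b) ≈ a - b
  [1+a]-[1+b]≈a-b a b = begin
    (1# + a) + - (1# + b)    ≈⟨ +-congˡ (sym (⁻¹-∙-comm 1# b)) ⟩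
    (1# + a) + (- 1# + - b)  ≈⟨ +-congʳ (+-comm 1# a) ⟩
    (a + 1#) + (- 1# + - b)  ≈⟨ +-assoc a 1# _ ⟩
    a + (1# + (- 1# + - b))  ≈⟨ +-congˡ (sym (+-assoc 1# (- 1#) (- b))) ⟩
    a + ((1# + - 1#) + - b)  ≈⟨ +-congˡ (+-congʳ (-‿inverseʳ 1#)) ⟩
    a + (0# + - b)           ≈⟨ +-congˡ (+-identityˡ (- b)) ⟩
    a + - b                  ∎

  ℤ⟶R-⊖ : ∀ m n → ℤ⟶R (m ℤ.⊖ n) ≈ m × 1# - n × 1#
  ℤ⟶R-⊖ zero    zero    = sym (trans (+-identityˡ _) -0#≈0#)
  ℤ⟶R-⊖ zero    (suc n) = sym (+-identityˡ _)
  ℤ⟶R-⊖ (suc m) zero    = sym (trans (+-congˡ -0#≈0#) (+-identityʳ _))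
  ℤ⟶R-⊖ (suc m) (suc n) rewrite ℤ.[1+m]⊖[1+n]≡m⊖n m n =
    trans (ℤ⟶R-⊖ m n) (sym ([1+a]-[1+b]≈a-b (m × 1#) (n × 1#)))

  ℤ⟶R-+ : ∀ i j → ℤ⟶R (i ℤ.+ j) ≈ ℤ⟶R i + ℤ⟶R j
  ℤ⟶R-+ (+ m)      (+ n)      = ×-homo-+ 1# m n
  ℤ⟶R-+ (+ m)      ℤ.-[1+ n ] = ℤ⟶R-⊖ m (suc n)
  ℤ⟶R-+ ℤ.-[1+ m ] (+ n)      = trans (ℤ⟶R-⊖ n (suc m)) (+-comm _ _)
  ℤ⟶R-+ ℤ.-[1+ m ] ℤ.-[1+ n ] = begin
    - (suc (suc (m ℕ.+ n)) × 1#)     ≈⟨ -‿cong (×-congˡ (≡.cong suc (≡.sym (ℕ.+-suc m n)))) ⟩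
    - ((suc m ℕ.+ suc n) × 1#)       ≈⟨ -‿cong (×-homo-+ 1# (suc m) (suc n)) ⟩
    - (suc m × 1# + suc n × 1#)      ≈⟨ ⁻¹-∙-comm _ _ ⟨
    - (suc m × 1#) + - (suc n × 1#)  ∎

  sign⟶R : Sign.Sign → Carrier
  sign⟶R Sign.+ = 1#
  sign⟶R Sign.- = - 1#

  ℤ⟶R-◃ : ∀ s n → ℤ⟶R (s ℤ.◃ n) ≈ sign⟶R s * (n × 1#)
  ℤ⟶R-◃ s      zero    = sym (zeroʳ _)
  ℤ⟶R-◃ Sign.+ (suc n) = sym (*-identityˡ _)
  ℤ⟶R-◃ Sign.- (suc n) = sym (-1*x≈-x _)

  sign⟶R-* : ∀ s t → sign⟶R (s Sign.* t) ≈ sign⟶R s * sign⟶R t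
  sign⟶R-* Sign.+ t      = sym (*-identityˡ _)
  sign⟶R-* Sign.- Sign.+ = sym (*-identityʳ _)
  sign⟶R-* Sign.- Sign.- = sym (trans (-1*x≈-x _) (-‿involutive _))

  ℤ⟶R-* : ∀ i j → ℤ⟶R (i ℤ.* j) ≈ ℤ⟶R i * ℤ⟶R j
  ℤ⟶R-* i j = begin
    ℤ⟶R (i ℤ.* j)
      ≈⟨ ℤ⟶R-◃ (ℤ.sign i Sign.* ℤ.sign j) (ℤ.∣ i ∣ ℕ.* ℤ.∣ j ∣) ⟩
    sign⟶R (ℤ.sign i Sign.* ℤ.sign j) * ((ℤ.∣ i ∣ ℕ.* ℤ.∣ j ∣) × 1#)
      ≈⟨ *-cong (sign⟶R-* (ℤ.sign i) (ℤ.sign j)) (×1-homo-* ℤ.∣ i ∣ ℤ.∣ j ∣) ⟩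
    (sign⟶R (ℤ.sign i) * sign⟶R (ℤ.sign j)) * ((ℤ.∣ i ∣ × 1#) * (ℤ.∣ j ∣ × 1#))
      ≈⟨ interchange _ _ _ _ ⟩
    (sign⟶R (ℤ.sign i) * (ℤ.∣ i ∣ × 1#)) * (sign⟶R (ℤ.sign j) * (ℤ.∣ j ∣ × 1#))
      ≈⟨ *-cong (ℤ⟶R-◃ (ℤ.sign i) ℤ.∣ i ∣) (ℤ⟶R-◃ (ℤ.sign j) ℤ.∣ j ∣) ⟨
    ℤ⟶R (ℤ.sign i ℤ.◃ ℤ.∣ i ∣) * ℤ⟶R (ℤ.sign j ℤ.◃ ℤ.∣ j ∣)
      ≡⟨ ≡.cong₂ (λ a b → ℤ⟶R a * ℤ⟶R b) (ℤ.◃-inverse i) (ℤ.◃-inverse j) ⟩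
    ℤ⟶R i * ℤ⟶R j ∎

  ℤ⟶R-neg : ∀ i → ℤ⟶R (ℤ.- i) ≈ - ℤ⟶R i
  ℤ⟶R-neg (+ zero)   = sym -0#≈0#
  ℤ⟶R-neg (+ suc n)  = refl
  ℤ⟶R-neg ℤ.-[1+ n ] = sym (-‿involutive _)

  ℤ⟶R-morphism : ℤ.+-*-rawRing -Raw-AlmostCommutative⟶ fromCommutativeRing R
  ℤ⟶R-morphism = record
    { ⟦_⟧ = ℤ⟶R ; +-homo = ℤ⟶R-+ ; *-homo = ℤ⟶R-* ; -‿homo = ℤ⟶R-neg
    ; 0-homo = refl ; 1-homo = +-identityʳ 1# }

  ℤ⟶R-≟ : ∀ i j → Maybe (ℤ⟶R i ≈ ℤ⟶R j)
  ℤ⟶R-≟ i j with i ℤ.≟ j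
  ... | yes ≡.refl = just refl
  ... | no _       = nothing

  open import Algebra.Solver.Ring ℤ.+-*-rawRing (fromCommutativeRing R) ℤ⟶R-morphism ℤ⟶R-≟ public
    using (solve; _:=_; _:+_; _:*_; :-_; _:-_; con)

module Polynomial (K : CommutativeRing 0ℓ 0ℓ) where
  open CommutativeRing K hiding (zero)
  open PolyOver 0# 1# _+_ _*_ -_ _≈_ public
  open import Algebra.Properties.Ring ring using (-0#≈0#; x∙y⁻¹≈ε⇒x≈y)
  open import Algebra.Definitions.RawSemiring (Semiring.rawSemiring semiring) using (_^_; sum; product)
  open import Algebra.Properties.CommutativeSemigroup +-commutativeSemigroup using (interchange)
  open import Data.List.Relation.Unary.All using ([]; _∷_; all?)
  open import Data.Product using (_×_)
  open import Data.Sum using (inj₁; inj₂)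
  open import Relation.Nullary using (map′)
  open import Relation.Binary.Structures using (IsEquivalence)
  open import Relation.Binary.Bundles using (Setoid)
  private module ≈-Reasoning = Relation.Binary.Reasoning.Setoid setoid

  coeff : Poly → ℕ → Carrier
  coeff []      i       = 0#
  coeff (a ∷ p) zero    = a
  coeff (a ∷ p) (suc i) = coeff p i

  infix 4 _≃_
  record _≃_ (p q : Poly) : Set where
    constructor mk≃
    field at : ∀ i → coeff p i ≈ coeff q i
  open _≃_ public

  ≃-refl : ∀ {p} → p ≃ p
  ≃-refl = mk≃ λ _ → refl

  ≃-sym : ∀ {p q} → p ≃ q → q ≃ p
  ≃-sym e = mk≃ λ i → sym (at e i)

  ≃-trans : ∀ {p q r} → p ≃ q → q ≃ r → p ≃ r
  ≃-trans e f = mk≃ λ i → trans (at e i) (at f i)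

  ≃-reflexive : ∀ {p q} → p ≡ q → p ≃ q
  ≃-reflexive ≡.refl = ≃-refl

  ≃-isEquivalence : IsEquivalence _≃_
  ≃-isEquivalence = record { refl = ≃-refl ; sym = ≃-sym ; trans = ≃-trans }

  ≃-setoid : Setoid 0ℓ 0ℓ
  ≃-setoid = record { isEquivalence = ≃-isEquivalence }

  module ≃-Reasoning = Relation.Binary.Reasoning.Setoid ≃-setoid

  ∷-cong : ∀ {a b p q} → a ≈ b → p ≃ q → (a ∷ p) ≃ (b ∷ q)
  ∷-cong a≈b p≃q = mk≃ λ { zero → a≈b ; (suc i) → at p≃q i }

  ∷-injective : ∀ {a b p q} → (a ∷ p) ≃ (b ∷ q) → a ≈ b × p ≃ q
  ∷-injective e = at e zero , mk≃ λ i → at e (suc i)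

  ∷≃[] : ∀ {a p} → a ≈ 0# → p ≃ [] → (a ∷ p) ≃ []
  ∷≃[] a≈0 p≃[] = mk≃ λ { zero → a≈0 ; (suc i) → at p≃[] i }

  ∷≃[]⁻¹ : ∀ {a p} → (a ∷ p) ≃ [] → a ≈ 0# × p ≃ []
  ∷≃[]⁻¹ e = at e zero , mk≃ λ i → at e (suc i)

  C0≃[] : C 0# ≃ []
  C0≃[] = ∷≃[] refl ≃-refl

  IsZero⇔≃[] : ∀ {p} → IsZero p ⇔ p ≃ []
  IsZero⇔≃[] = mk⇔ to from
    where
    to : ∀ {p} → IsZero p → p ≃ []
    to []         = ≃-refl
    to (a≈0 ∷ z) = ∷≃[] a≈0 (to z)
    from : ∀ {p} → p ≃ [] → IsZero p
    from {[]}    _ = []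
    from {a ∷ p} e = proj₁ (∷≃[]⁻¹ e) ∷ from (proj₂ (∷≃[]⁻¹ e))

  coeff-⊕ : ∀ p q i → coeff (p ⊕ q) i ≈ coeff p i + coeff q i
  coeff-⊕ []      q       i       = sym (+-identityˡ _)
  coeff-⊕ (a ∷ p) []      i       = sym (+-identityʳ _)
  coeff-⊕ (a ∷ p) (b ∷ q) zero    = refl
  coeff-⊕ (a ∷ p) (b ∷ q) (suc i) = coeff-⊕ p q i

  coeff-scale : ∀ a p i → coeff (scale a p) i ≈ a * coeff p i
  coeff-scale a []      i       = sym (zeroʳ a)
  coeff-scale a (b ∷ p) zero    = refl
  coeff-scale a (b ∷ p) (suc i) = coeff-scale a p i

  coeff-⊖ : ∀ p i → coeff (⊖ p) i ≈ - coeff p i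
  coeff-⊖ []      i       = sym -0#≈0#
  coeff-⊖ (b ∷ p) zero    = refl
  coeff-⊖ (b ∷ p) (suc i) = coeff-⊖ p i

  ⊕-cong : ∀ {p p′ q q′} → p ≃ p′ → q ≃ q′ → (p ⊕ q) ≃ (p′ ⊕ q′)
  ⊕-cong {p} {p′} {q} {q′} e f = mk≃ λ i →
    trans (coeff-⊕ p q i) (trans (+-cong (at e i) (at f i)) (sym (coeff-⊕ p′ q′ i)))

  ⊖-cong : ∀ {p q} → p ≃ q → (⊖ p) ≃ (⊖ q)
  ⊖-cong {p} {q} e = mk≃ λ i → trans (coeff-⊖ p i) (trans (-‿cong (at e i)) (sym (coeff-⊖ q i)))

  scale-cong : ∀ {a b p q} → a ≈ b → p ≃ q → scale a p ≃ scale b q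
  scale-cong {a} {b} {p} {q} e f = mk≃ λ i →
    trans (coeff-scale a p i) (trans (*-cong e (at f i)) (sym (coeff-scale b q i)))

  ⊕-comm : ∀ p q → (p ⊕ q) ≃ (q ⊕ p)
  ⊕-comm p q = mk≃ λ i → trans (coeff-⊕ p q i) (trans (+-comm _ _) (sym (coeff-⊕ q p i)))

  ⊕-assoc : ∀ p q r → ((p ⊕ q) ⊕ r) ≃ (p ⊕ (q ⊕ r))
  ⊕-assoc p q r = mk≃ λ i → begin
    coeff ((p ⊕ q) ⊕ r) i                ≈⟨ coeff-⊕ (p ⊕ q) r i ⟩
    coeff (p ⊕ q) i + coeff r i          ≈⟨ +-congʳ (coeff-⊕ p q i) ⟩
    (coeff p i + coeff q i) + coeff r i  ≈⟨ +-assoc _ _ _ ⟩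
    coeff p i + (coeff q i + coeff r i)  ≈⟨ +-congˡ (coeff-⊕ q r i) ⟨
    coeff p i + coeff (q ⊕ r) i          ≈⟨ coeff-⊕ p (q ⊕ r) i ⟨
    coeff (p ⊕ (q ⊕ r)) i                ∎
    where open ≈-Reasoning

  ⊕-identityʳ : ∀ p → (p ⊕ []) ≃ p
  ⊕-identityʳ p = mk≃ λ i → trans (coeff-⊕ p [] i) (+-identityʳ _)

  ⊕-inverseʳ : ∀ p → (p ⊕ (⊖ p)) ≃ []
  ⊕-inverseʳ p = mk≃ λ i →
    trans (coeff-⊕ p (⊖ p) i) (trans (+-congˡ (coeff-⊖ p i)) (-‿inverseʳ _))

  ⊕-interchange : ∀ p q r s → ((p ⊕ q) ⊕ (r ⊕ s)) ≃ ((p ⊕ r) ⊕ (q ⊕ s))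
  ⊕-interchange p q r s = mk≃ λ i → begin
    coeff ((p ⊕ q) ⊕ (r ⊕ s)) i                                ≈⟨ coeff-⊕ (p ⊕ q) (r ⊕ s) i ⟩
    coeff (p ⊕ q) i + coeff (r ⊕ s) i                          ≈⟨ +-cong (coeff-⊕ p q i) (coeff-⊕ r s i) ⟩
    (coeff p i + coeff q i) + (coeff r i + coeff s i)          ≈⟨ interchange _ _ _ _ ⟩
    (coeff p i + coeff r i) + (coeff q i + coeff s i)          ≈⟨ +-cong (coeff-⊕ p r i) (coeff-⊕ q s i) ⟨
    coeff (p ⊕ r) i + coeff (q ⊕ s) i                          ≈⟨ coeff-⊕ (p ⊕ r) (q ⊕ s) i ⟨
    coeff ((p ⊕ r) ⊕ (q ⊕ s)) i                                ∎
    where open ≈-Reasoning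

  0∷-⊕ : ∀ p q → (0# ∷ (p ⊕ q)) ≃ ((0# ∷ p) ⊕ (0# ∷ q))
  0∷-⊕ p q = ∷-cong (sym (+-identityˡ 0#)) ≃-refl

  scale-zero : ∀ {a} p → a ≈ 0# → scale a p ≃ []
  scale-zero {a} p a≈0 = mk≃ λ i → trans (coeff-scale a p i) (trans (*-congʳ a≈0) (zeroˡ _))

  scale-⊕ : ∀ a p q → scale a (p ⊕ q) ≃ (scale a p ⊕ scale a q)
  scale-⊕ a p q = mk≃ λ i → begin
    coeff (scale a (p ⊕ q)) i                  ≈⟨ coeff-scale a (p ⊕ q) i ⟩
    a * coeff (p ⊕ q) i                        ≈⟨ *-congˡ (coeff-⊕ p q i) ⟩
    a * (coeff p i + coeff q i)                ≈⟨ distribˡ _ _ _ ⟩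
    a * coeff p i + a * coeff q i              ≈⟨ +-cong (coeff-scale a p i) (coeff-scale a q i) ⟨
    coeff (scale a p) i + coeff (scale a q) i  ≈⟨ coeff-⊕ (scale a p) (scale a q) i ⟨
    coeff (scale a p ⊕ scale a q) i            ∎
    where open ≈-Reasoning

  scale-+ : ∀ a b p → scale (a + b) p ≃ (scale a p ⊕ scale b p)
  scale-+ a b p = mk≃ λ i → begin
    coeff (scale (a + b) p) i                  ≈⟨ coeff-scale (a + b) p i ⟩
    (a + b) * coeff p i                        ≈⟨ distribʳ _ _ _ ⟩
    a * coeff p i + b * coeff p i              ≈⟨ +-cong (coeff-scale a p i) (coeff-scale b p i) ⟨
    coeff (scale a p) i + coeff (scale b p) i  ≈⟨ coeff-⊕ (scale a p) (scale b p) i ⟨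
    coeff (scale a p ⊕ scale b p) i            ∎
    where open ≈-Reasoning

  scale-scale : ∀ a b p → scale a (scale b p) ≃ scale (a * b) p
  scale-scale a b p = mk≃ λ i → begin
    coeff (scale a (scale b p)) i  ≈⟨ coeff-scale a (scale b p) i ⟩
    a * coeff (scale b p) i        ≈⟨ *-congˡ (coeff-scale b p i) ⟩
    a * (b * coeff p i)            ≈⟨ *-assoc _ _ _ ⟨
    (a * b) * coeff p i            ≈⟨ coeff-scale (a * b) p i ⟨
    coeff (scale (a * b) p) i      ∎
    where open ≈-Reasoning

  scale-1 : ∀ p → scale 1# p ≃ p
  scale-1 p = mk≃ λ i → trans (coeff-scale 1# p i) (*-identityˡ _)

  0∷-⊗ : ∀ p q → ((0# ∷ p) ⊗ q) ≃ (0# ∷ (p ⊗ q))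
  0∷-⊗ p q = ⊕-cong (scale-zero q refl) ≃-refl

  ⊗-zeroˡ : ∀ {p} q → p ≃ [] → (p ⊗ q) ≃ []
  ⊗-zeroˡ {[]}    q e = ≃-refl
  ⊗-zeroˡ {a ∷ p} q e =
    ≃-trans (⊕-cong (scale-zero q (proj₁ (∷≃[]⁻¹ e))) (∷≃[] refl (⊗-zeroˡ q (proj₂ (∷≃[]⁻¹ e)))))
            ≃-refl

  ⊗-congˡ : ∀ {p p′} q → p ≃ p′ → (p ⊗ q) ≃ (p′ ⊗ q)
  ⊗-congˡ {[]}    {p′}     q e = ≃-sym (⊗-zeroˡ q (≃-sym e))
  ⊗-congˡ {a ∷ p} {[]}     q e = ⊗-zeroˡ q e
  ⊗-congˡ {a ∷ p} {b ∷ p′} q e =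
    ⊕-cong (scale-cong (proj₁ (∷-injective e)) ≃-refl) (∷-cong refl (⊗-congˡ q (proj₂ (∷-injective e))))

  ⊗-zeroʳ : ∀ p → (p ⊗ []) ≃ []
  ⊗-zeroʳ []      = ≃-refl
  ⊗-zeroʳ (a ∷ p) = ∷≃[] refl (⊗-zeroʳ p)

  ⊗-∷ʳ : ∀ p b q → (p ⊗ (b ∷ q)) ≃ (scale b p ⊕ (0# ∷ (p ⊗ q)))
  ⊗-∷ʳ []      b q = ≃-sym (∷≃[] refl ≃-refl)
  ⊗-∷ʳ (a ∷ p) b q = ∷-cong (+-congʳ (*-comm a b)) (begin
    scale a q ⊕ (p ⊗ (b ∷ q))                      ≈⟨ ⊕-cong ≃-refl (⊗-∷ʳ p b q) ⟩
    scale a q ⊕ (scale b p ⊕ (0# ∷ (p ⊗ q)))       ≈⟨ ⊕-assoc (scale a q) (scale b p) (0# ∷ (p ⊗ q)) ⟨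
    (scale a q ⊕ scale b p) ⊕ (0# ∷ (p ⊗ q))       ≈⟨ ⊕-cong (⊕-comm (scale a q) (scale b p)) ≃-refl ⟩
    (scale b p ⊕ scale a q) ⊕ (0# ∷ (p ⊗ q))       ≈⟨ ⊕-assoc (scale b p) (scale a q) (0# ∷ (p ⊗ q)) ⟩
    scale b p ⊕ (scale a q ⊕ (0# ∷ (p ⊗ q)))       ∎)
    where open ≃-Reasoning

  ⊗-comm : ∀ p q → (p ⊗ q) ≃ (q ⊗ p)
  ⊗-comm []      q = ≃-sym (⊗-zeroʳ q)
  ⊗-comm (a ∷ p) q = ≃-trans (⊕-cong ≃-refl (∷-cong refl (⊗-comm p q))) (≃-sym (⊗-∷ʳ q a p))

  ⊗-congʳ : ∀ p {q q′} → q ≃ q′ → (p ⊗ q) ≃ (p ⊗ q′)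
  ⊗-congʳ p {q} {q′} e = ≃-trans (⊗-comm p q) (≃-trans (⊗-congˡ p e) (⊗-comm q′ p))

  ⊗-cong : ∀ {p p′ q q′} → p ≃ p′ → q ≃ q′ → (p ⊗ q) ≃ (p′ ⊗ q′)
  ⊗-cong {p′ = p′} {q} e f = ≃-trans (⊗-congˡ q e) (⊗-congʳ p′ f)

  ⊗-distribʳ : ∀ r p q → ((p ⊕ q) ⊗ r) ≃ ((p ⊗ r) ⊕ (q ⊗ r))
  ⊗-distribʳ r []      q       = ≃-refl
  ⊗-distribʳ r (a ∷ p) []      = ≃-sym (⊕-identityʳ _)
  ⊗-distribʳ r (a ∷ p) (b ∷ q) = begin
    scale (a + b) r ⊕ (0# ∷ ((p ⊕ q) ⊗ r))
      ≈⟨ ⊕-cong (scale-+ a b r) (≃-trans (∷-cong refl (⊗-distribʳ r p q)) (0∷-⊕ (p ⊗ r) (q ⊗ r))) ⟩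
    (scale a r ⊕ scale b r) ⊕ ((0# ∷ (p ⊗ r)) ⊕ (0# ∷ (q ⊗ r)))
      ≈⟨ ⊕-interchange (scale a r) (scale b r) (0# ∷ (p ⊗ r)) (0# ∷ (q ⊗ r)) ⟩
    (scale a r ⊕ (0# ∷ (p ⊗ r))) ⊕ (scale b r ⊕ (0# ∷ (q ⊗ r))) ∎
    where open ≃-Reasoning

  ⊗-distribˡ : ∀ p q r → (p ⊗ (q ⊕ r)) ≃ ((p ⊗ q) ⊕ (p ⊗ r))
  ⊗-distribˡ p q r =
    ≃-trans (⊗-comm p (q ⊕ r)) (≃-trans (⊗-distribʳ p q r) (⊕-cong (⊗-comm q p) (⊗-comm r p)))

  scale-⊗ : ∀ a p q → scale a (p ⊗ q) ≃ (scale a p ⊗ q)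
  scale-⊗ a []      q = ≃-refl
  scale-⊗ a (b ∷ p) q = begin
    scale a (scale b q ⊕ (0# ∷ (p ⊗ q)))           ≈⟨ scale-⊕ a (scale b q) (0# ∷ (p ⊗ q)) ⟩
    scale a (scale b q) ⊕ (a * 0# ∷ scale a (p ⊗ q)) ≈⟨ ⊕-cong (scale-scale a b q) (∷-cong (zeroʳ a) (scale-⊗ a p q)) ⟩
    scale (a * b) q ⊕ (0# ∷ (scale a p ⊗ q))       ∎
    where open ≃-Reasoning

  ⊗-assoc : ∀ p q r → ((p ⊗ q) ⊗ r) ≃ (p ⊗ (q ⊗ r))
  ⊗-assoc []      q r = ≃-refl
  ⊗-assoc (a ∷ p) q r = begin
    (scale a q ⊕ (0# ∷ (p ⊗ q))) ⊗ r            ≈⟨ ⊗-distribʳ r (scale a q) (0# ∷ (p ⊗ q)) ⟩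
    (scale a q ⊗ r) ⊕ ((0# ∷ (p ⊗ q)) ⊗ r)      ≈⟨ ⊕-cong (≃-sym (scale-⊗ a q r)) (0∷-⊗ (p ⊗ q) r) ⟩
    scale a (q ⊗ r) ⊕ (0# ∷ ((p ⊗ q) ⊗ r))      ≈⟨ ⊕-cong ≃-refl (∷-cong refl (⊗-assoc p q r)) ⟩
    scale a (q ⊗ r) ⊕ (0# ∷ (p ⊗ (q ⊗ r)))      ∎
    where open ≃-Reasoning

  ⊗-identityˡ : ∀ p → (one ⊗ p) ≃ p
  ⊗-identityˡ p = ≃-trans (⊕-cong (scale-1 p) C0≃[]) (⊕-identityʳ p)

  ⊗-identityʳ : ∀ p → (p ⊗ one) ≃ p
  ⊗-identityʳ p = ≃-trans (⊗-comm p one) (⊗-identityˡ p)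

  polyCommutativeRing : CommutativeRing 0ℓ 0ℓ
  polyCommutativeRing = record
    { Carrier = Poly ; _≈_ = _≃_ ; _+_ = _⊕_ ; _*_ = _⊗_ ; -_ = ⊖_ ; 0# = [] ; 1# = one
    ; isCommutativeRing = record
      { isRing = record
        { +-isAbelianGroup = record
          { isGroup = record
            { isMonoid = record
              { isSemigroup = record
                { isMagma = record { isEquivalence = ≃-isEquivalence ; ∙-cong = ⊕-cong }
                ; assoc = ⊕-assoc }
              ; identity = (λ _ → ≃-refl) , ⊕-identityʳ }
            ; inverse = (λ p → ≃-trans (⊕-comm (⊖ p) p) (⊕-inverseʳ p)) , ⊕-inverseʳ
            ; ⁻¹-cong = ⊖-cong }
          ; comm = ⊕-comm }
        ; *-cong = ⊗-cong
        ; *-assoc = ⊗-assoc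
        ; *-identity = ⊗-identityˡ , ⊗-identityʳ
        ; distrib = ⊗-distribˡ , ⊗-distribʳ }
      ; *-comm = ⊗-comm } }

  ∑-cong : ∀ {m} {f g : Fin m → Poly} → (∀ i → f i ≃ g i) → ∑ f ≃ ∑ g
  ∑-cong {zero}  f≃g = ≃-refl
  ∑-cong {suc m} f≃g = ⊕-cong (f≃g fzero) (∑-cong (f≃g ∘ fsuc))

  ∏-cong : ∀ {m} {f g : Fin m → Poly} → (∀ i → f i ≃ g i) → ∏ f ≃ ∏ g
  ∏-cong {zero}  f≃g = ≃-refl
  ∏-cong {suc m} f≃g = ⊗-cong (f≃g fzero) (∏-cong (f≃g ∘ fsuc))

  ^ₚ-congˡ : ∀ {p q} m → p ≃ q → (p ^ₚ m) ≃ (q ^ₚ m)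
  ^ₚ-congˡ zero    p≃q = ≃-refl
  ^ₚ-congˡ (suc m) p≃q = ⊗-cong p≃q (^ₚ-congˡ m p≃q)

  ≋⇔≃ : ∀ {p q} → p ≋ q ⇔ p ≃ q
  ≋⇔≃ {p} {q} = mk⇔
    (λ p≋q → mk≃ λ i → x∙y⁻¹≈ε⇒x≈y _ _ (begin
      coeff p i - coeff q i    ≈⟨ +-congˡ (coeff-⊖ q i) ⟨
      coeff p i + coeff (⊖ q) i ≈⟨ coeff-⊕ p (⊖ q) i ⟨
      coeff (p ⊝ q) i          ≈⟨ at (Equivalence.to IsZero⇔≃[] p≋q) i ⟩
      0#                       ∎))
    (λ p≃q → Equivalence.from IsZero⇔≃[] (≃-trans (⊕-cong p≃q ≃-refl) (⊕-inverseʳ q)))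
    where open ≈-Reasoning

  open import Algebra.Definitions.RawMagma (CommutativeRing.*-rawMagma polyCommutativeRing)
    public using (_∣_; _,_)

  ∣ₚ⇔∣ : ∀ {d p} → d ∣ₚ p ⇔ d ∣ p
  ∣ₚ⇔∣ {d} {p} = mk⇔
    (λ (c , p≋dc) → c , ≃-trans (⊗-comm c d) (≃-sym (Equivalence.to ≋⇔≃ p≋dc)))
    (λ (c , cd≃p) → c , Equivalence.from ≋⇔≃ (≃-sym (≃-trans (⊗-comm d c) cd≃p)))

  ∣-resp-≃ : ∀ {d d′ p p′} → d ≃ d′ → p ≃ p′ → d ∣ p → d′ ∣ p′
  ∣-resp-≃ {d} {d′} d≃d′ p≃p′ (c , cd≃p) = c , ≃-trans (⊗-congʳ c (≃-sym d≃d′)) (≃-trans cd≃p p≃p′)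

  eval : Poly → Carrier → Carrier
  eval []      x = 0#
  eval (a ∷ p) x = a + x * eval p x

  eval-≃[] : ∀ {p} x → p ≃ [] → eval p x ≈ 0#
  eval-≃[] {[]}    x e = refl
  eval-≃[] {a ∷ p} x e = begin
    a + x * eval p x  ≈⟨ +-cong (proj₁ (∷≃[]⁻¹ e)) (*-congˡ (eval-≃[] x (proj₂ (∷≃[]⁻¹ e)))) ⟩
    0# + x * 0#       ≈⟨ +-identityˡ _ ⟩
    x * 0#            ≈⟨ zeroʳ x ⟩
    0#                ∎
    where open ≈-Reasoning

  eval-cong : ∀ {p q} x → p ≃ q → eval p x ≈ eval q x
  eval-cong {[]}    {q}     x e = sym (eval-≃[] x (≃-sym e))
  eval-cong {a ∷ p} {[]}    x e = eval-≃[] x e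
  eval-cong {a ∷ p} {b ∷ q} x e =
    +-cong (proj₁ (∷-injective e)) (*-congˡ (eval-cong x (proj₂ (∷-injective e))))

  eval-congʳ : ∀ p {x y} → x ≈ y → eval p x ≈ eval p y
  eval-congʳ []      x≈y = refl
  eval-congʳ (a ∷ p) x≈y = +-congˡ (*-cong x≈y (eval-congʳ p x≈y))

  eval-C : ∀ a x → eval (C a) x ≈ a
  eval-C a x = trans (+-congˡ (zeroʳ x)) (+-identityʳ a)

  eval-X : ∀ x → eval X x ≈ x
  eval-X x = trans (+-identityˡ _) (trans (*-congˡ (eval-C 1# x)) (*-identityʳ x))

  eval-⊕ : ∀ p q x → eval (p ⊕ q) x ≈ eval p x + eval q x
  eval-⊕ []      q       x = sym (+-identityˡ _)
  eval-⊕ (a ∷ p) []      x = sym (+-identityʳ _)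
  eval-⊕ (a ∷ p) (b ∷ q) x = trans (+-congˡ (*-congˡ (eval-⊕ p q x)))
    (solve 5 (λ a b x P Q → (a :+ b) :+ x :* (P :+ Q) := (a :+ x :* P) :+ (b :+ x :* Q))
           refl a b x (eval p x) (eval q x))
    where open CommutativeRingSolver K

  eval-scale : ∀ a p x → eval (scale a p) x ≈ a * eval p x
  eval-scale a []      x = sym (zeroʳ a)
  eval-scale a (b ∷ p) x = trans (+-congˡ (*-congˡ (eval-scale a p x)))
    (solve 4 (λ a b x P → a :* b :+ x :* (a :* P) := a :* (b :+ x :* P)) refl a b x (eval p x))
    where open CommutativeRingSolver K

  eval-⊖ : ∀ p x → eval (⊖ p) x ≈ - eval p x
  eval-⊖ []      x = sym -0#≈0#
  eval-⊖ (b ∷ p) x = trans (+-congˡ (*-congˡ (eval-⊖ p x)))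
    (solve 3 (λ b x P → :- b :+ x :* (:- P) := :- (b :+ x :* P)) refl b x (eval p x))
    where open CommutativeRingSolver K

  eval-⊗ : ∀ p q x → eval (p ⊗ q) x ≈ eval p x * eval q x
  eval-⊗ []      q x = sym (zeroˡ _)
  eval-⊗ (a ∷ p) q x = begin
    eval (scale a q ⊕ (0# ∷ (p ⊗ q))) x            ≈⟨ eval-⊕ (scale a q) (0# ∷ (p ⊗ q)) x ⟩
    eval (scale a q) x + (0# + x * eval (p ⊗ q) x)  ≈⟨ +-cong (eval-scale a q x) (+-congˡ (*-congˡ (eval-⊗ p q x))) ⟩
    a * Q + (0# + x * (P * Q))                      ≈⟨ solve 4 (λ a x P Q → a :* Q :+ (con (+ 0) :+ x :* (P :* Q)) := (a :+ x :* P) :* Q) refl a x P Q ⟩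
    (a + x * P) * Q                                 ∎
    where
    open ≈-Reasoning
    open CommutativeRingSolver K
    P Q : Carrier
    P = eval p x
    Q = eval q x

  eval-^ : ∀ p m x → eval (p ^ₚ m) x ≈ eval p x ^ m
  eval-^ p zero    x = eval-C 1# x
  eval-^ p (suc m) x = trans (eval-⊗ p (p ^ₚ m) x) (*-congˡ (eval-^ p m x))

  eval-∏ : ∀ {m} (f : Fin m → Poly) x → eval (∏ f) x ≈ product (λ i → eval (f i) x)
  eval-∏ {zero}  f x = eval-C 1# x
  eval-∏ {suc m} f x = trans (eval-⊗ (f fzero) (∏ (f ∘ fsuc)) x) (*-congˡ (eval-∏ (f ∘ fsuc) x))

  eval-∑ : ∀ {m} (f : Fin m → Poly) x → eval (∑ f) x ≈ sum (λ i → eval (f i) x)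
  eval-∑ {zero}  f x = refl
  eval-∑ {suc m} f x = trans (eval-⊕ (f fzero) (∑ (f ∘ fsuc)) x) (+-congˡ (eval-∑ (f ∘ fsuc) x))

  X⊗ : ∀ p → (X ⊗ p) ≃ (0# ∷ p)
  X⊗ p = ≃-trans (0∷-⊗ one p) (∷-cong refl (⊗-identityˡ p))

  ∷≃C⊕X⊗ : ∀ a p → (a ∷ p) ≃ (C a ⊕ (X ⊗ p))
  ∷≃C⊕X⊗ a p = ≃-sym (≃-trans (⊕-cong (≃-refl {C a}) (X⊗ p)) (∷-cong (+-identityʳ a) ≃-refl))

  remainder-theorem : ∀ p r → Σ Poly λ Q → p ≃ ((X ⊝ C r) ⊗ Q) ⊕ C (eval p r)
  remainder-theorem []      r = [] , ≃-sym (≃-trans (⊕-cong (⊗-zeroʳ (X ⊝ C r)) C0≃[]) ≃-refl)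
  remainder-theorem (a ∷ p) r with remainder-theorem p r
  ... | Q , p≃ = (X ⊗ Q) ⊕ C v , (begin
    a ∷ p                                              ≈⟨ ∷≃C⊕X⊗ a p ⟩
    C a ⊕ (X ⊗ p)                                      ≈⟨ ⊕-cong (≃-refl {C a}) (⊗-congʳ X p≃) ⟩
    C a ⊕ (X ⊗ (((X ⊝ C r) ⊗ Q) ⊕ C v))                ≈⟨ solve 5 (λ Ca x Q Cv Cr →
                                                            Ca :+ x :* ((x :- Cr) :* Q :+ Cv)
                                                         := (x :- Cr) :* (x :* Q :+ Cv) :+ (Ca :+ Cr :* Cv))
                                                          ≃-refl (C a) X Q (C v) (C r) ⟩
    ((X ⊝ C r) ⊗ ((X ⊗ Q) ⊕ C v)) ⊕ (C a ⊕ (C r ⊗ C v)) ≈⟨ ⊕-cong ≃-refl (∷-cong (+-congˡ (+-identityʳ _)) ≃-refl) ⟩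
    ((X ⊝ C r) ⊗ ((X ⊗ Q) ⊕ C v)) ⊕ C (a + r * v)      ∎)
    where
    open ≃-Reasoning
    open CommutativeRingSolver polyCommutativeRing
    v : Carrier
    v = eval p r

  1-[_]X : Carrier → Poly
  1-[ c ]X = one ⊝ (C c ⊗ X)

  eval-1-[c]X : ∀ c x → eval 1-[ c ]X x ≈ 1# - c * x
  eval-1-[c]X c x = begin
    eval (one ⊕ (⊖ (C c ⊗ X))) x      ≈⟨ eval-⊕ one (⊖ (C c ⊗ X)) x ⟩
    eval one x + eval (⊖ (C c ⊗ X)) x ≈⟨ +-cong (eval-C 1# x) (eval-⊖ (C c ⊗ X) x) ⟩
    1# - eval (C c ⊗ X) x             ≈⟨ +-congˡ (-‿cong (eval-⊗ (C c) X x)) ⟩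
    1# - eval (C c) x * eval X x      ≈⟨ +-congˡ (-‿cong (*-cong (eval-C c x) (eval-X x))) ⟩
    1# - c * x                        ∎
    where open ≈-Reasoning

  C-* : ∀ a b → C (a * b) ≃ (C a ⊗ C b)
  C-* a b = ∷-cong (sym (+-identityʳ _)) ≃-refl

  -- Since c r = 1, the factor X - r of the remainder theorem is the unit multiple -r (1 - c X).
  factor-theorem : ∀ {c r p} → c * r ≈ 1# → eval p r ≈ 0# → 1-[ c ]X ∣ p
  factor-theorem {c} {r} {p} cr≈1 p[r]≈0 with remainder-theorem p r
  ... | Q , p≃ = C (- r) ⊗ Q , (begin
    (C (- r) ⊗ Q) ⊗ 1-[ c ]X            ≈⟨ solve 4 (λ Cc Cr x Q → ((:- Cr) :* Q) :* (con (+ 1) :- Cc :* x)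
                                                   := ((Cc :* Cr) :* x :- Cr) :* Q) ≃-refl (C c) (C r) X Q ⟩
    (((C c ⊗ C r) ⊗ X) ⊝ C r) ⊗ Q       ≈⟨ ⊗-congˡ Q (⊕-cong (⊗-congˡ X CcCr≃1) (≃-refl {⊖ C r})) ⟩
    ((one ⊗ X) ⊝ C r) ⊗ Q               ≈⟨ ⊗-congˡ Q (⊕-cong (⊗-identityˡ X) (≃-refl {⊖ C r})) ⟩
    (X ⊝ C r) ⊗ Q                       ≈⟨ ⊕-identityʳ ((X ⊝ C r) ⊗ Q) ⟨
    ((X ⊝ C r) ⊗ Q) ⊕ []                ≈⟨ ⊕-cong (≃-refl {(X ⊝ C r) ⊗ Q}) r≃0 ⟨
    ((X ⊝ C r) ⊗ Q) ⊕ C (eval p r)      ≈⟨ p≃ ⟨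
    p                                   ∎)
    where
    open ≃-Reasoning
    open CommutativeRingSolver polyCommutativeRing
    r≃0 : C (eval p r) ≃ []
    r≃0 = ∷≃[] p[r]≈0 ≃-refl
    CcCr≃1 : (C c ⊗ C r) ≃ one
    CcCr≃1 = ≃-trans (≃-sym (C-* c r)) (∷-cong cr≈1 ≃-refl)

  linearFactors : (ℕ → Carrier) → ℕ → Poly
  linearFactors c zero    = one
  linearFactors c (suc m) = linearFactors c m ⊗ 1-[ c m ]X

  module _ (1≉0 : ¬ 1# ≈ 0#) (cancel : ∀ {a b} → ¬ a ≈ 0# → a * b ≈ 0# → b ≈ 0#) where

    eval-linearFactors≉0 : ∀ c m x → (∀ {j} → j ℕ.< m → ¬ c j * x ≈ 1#) →
                           ¬ eval (linearFactors c m) x ≈ 0#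
    eval-linearFactors≉0 c zero    x _   e = 1≉0 (trans (sym (eval-C 1# x)) e)
    eval-linearFactors≉0 c (suc m) x c≉ e = c≉ (ℕ.n<1+n m) (sym (x∙y⁻¹≈ε⇒x≈y 1# (c m * x) (begin
      1# - c m * x              ≈⟨ eval-1-[c]X (c m) x ⟨
      eval 1-[ c m ]X x          ≈⟨ cancel (eval-linearFactors≉0 c m x (λ j<m → c≉ (ℕ.m<n⇒m<1+n j<m)))
                                          (trans (sym (eval-⊗ (linearFactors c m) 1-[ c m ]X x)) e) ⟩
      0#                         ∎)))
      where open ≈-Reasoning

    -- By induction on m: r m is no root of the earlier factors, so it is a root of the quotient.
    linearFactors∣⇔roots : (c r : ℕ → Carrier) → (∀ i → c i * r i ≈ 1#) → (∀ {i j} → j ℕ.< i → ¬ c j * r i ≈ 1#) →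
                           ∀ m p → linearFactors c m ∣ p ⇔ (∀ {i} → i ℕ.< m → eval p (r i) ≈ 0#)
    linearFactors∣⇔roots c r c*r≈1 separated m p = mk⇔ (roots m p) (divides m p)
      where
      root : ∀ {m i} → i ℕ.< m → eval (linearFactors c m) (r i) ≈ 0#
      root {suc m} {i} (ℕ.s≤s i≤m) with ℕ.m≤n⇒m<n∨m≡n i≤m
      ... | inj₁ i<m    = trans (eval-⊗ (linearFactors c m) 1-[ c m ]X (r i))
                                (trans (*-congʳ (root i<m)) (zeroˡ _))
      ... | inj₂ ≡.refl = trans (eval-⊗ (linearFactors c m) 1-[ c m ]X (r i))
                                (trans (*-congˡ (trans (eval-1-[c]X (c i) (r i))
                                         (trans (+-congˡ (-‿cong (c*r≈1 i))) (-‿inverseʳ 1#))))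
                                       (zeroʳ _))

      roots : ∀ m p → linearFactors c m ∣ p → ∀ {i} → i ℕ.< m → eval p (r i) ≈ 0#
      roots m p (Q , Q⊗L≃p) {i} i<m = begin
        eval p (r i)                                           ≈⟨ eval-cong (r i) Q⊗L≃p ⟨
        eval (Q ⊗ linearFactors c m) (r i)                     ≈⟨ eval-⊗ Q (linearFactors c m) (r i) ⟩
        eval Q (r i) * eval (linearFactors c m) (r i)          ≈⟨ *-congˡ (root i<m) ⟩
        eval Q (r i) * 0#                                      ≈⟨ zeroʳ _ ⟩
        0#                                                     ∎
        where open ≈-Reasoning

      divides : ∀ m p → (∀ {i} → i ℕ.< m → eval p (r i) ≈ 0#) → linearFactors c m ∣ p
      divides zero    p _     = p , ⊗-identityʳ p
      divides (suc m) p roots = extend (divides m p (λ i<m → roots (ℕ.m<n⇒m<1+n i<m))) (roots (ℕ.n<1+n m))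
        where
        L : Poly
        L = linearFactors c m
        extend : L ∣ p → eval p (r m) ≈ 0# → (L ⊗ 1-[ c m ]X) ∣ p
        extend (Q , Q⊗L≃p) p[rm]≈0 = extend′ (factor-theorem {c m} {r m} {Q} (c*r≈1 m) Q[rm]≈0)
          where
          Q[rm]≈0 : eval Q (r m) ≈ 0#
          Q[rm]≈0 = cancel (eval-linearFactors≉0 c m (r m) (separated {m})) (trans (*-comm (eval L (r m)) (eval Q (r m)))
            (trans (sym (eval-⊗ Q L (r m))) (trans (eval-cong (r m) Q⊗L≃p) p[rm]≈0)))
          extend′ : 1-[ c m ]X ∣ Q → (L ⊗ 1-[ c m ]X) ∣ p
          extend′ (Q′ , Q′⊗l≃Q) = Q′ , (begin
            Q′ ⊗ (L ⊗ 1-[ c m ]X)    ≈⟨ solve 3 (λ Q′ L l → Q′ :* (L :* l) := (Q′ :* l) :* L) ≃-refl Q′ L 1-[ c m ]X ⟩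
            (Q′ ⊗ 1-[ c m ]X) ⊗ L    ≈⟨ ⊗-congˡ L Q′⊗l≃Q ⟩
            Q ⊗ L                    ≈⟨ Q⊗L≃p ⟩
            p                        ∎)
            where
            open ≃-Reasoning
            open CommutativeRingSolver polyCommutativeRing

  module _ (_≟0 : ∀ a → Dec (a ≈ 0#)) (cancel : ∀ {a b} → ¬ a ≈ 0# → a * b ≈ 0# → b ≈ 0#) where

    ≃[]? : ∀ p → Dec (p ≃ [])
    ≃[]? p = map′ (Equivalence.to IsZero⇔≃[]) (Equivalence.from IsZero⇔≃[]) (all? _≟0 p)

    -- Compare the lowest nonzero coefficients of both factors.
    ⊗≄[] : ∀ {p q} → ¬ p ≃ [] → ¬ q ≃ [] → ¬ (p ⊗ q) ≃ []
    ⊗≄[] {[]}    {q} p≄[] _    _ = p≄[] ≃-refl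
    ⊗≄[] {a ∷ p} {q} p≄[] q≄[] e with a ≟0
    ... | yes a≈0 = ⊗≄[] (λ p≃[] → p≄[] (∷≃[] a≈0 p≃[])) q≄[] (proj₂ (∷≃[]⁻¹ (begin
      0# ∷ (p ⊗ q)      ≈⟨ 0∷-⊗ p q ⟨
      (0# ∷ p) ⊗ q      ≈⟨ ⊗-congˡ q (∷-cong (sym a≈0) (≃-refl {p})) ⟩
      (a ∷ p) ⊗ q       ≈⟨ e ⟩
      []                ∎)))
      where open ≃-Reasoning
    ... | no a≉0 = lowest a≉0 q≄[] e
      where
      lowest : ∀ {q} → ¬ a ≈ 0# → ¬ q ≃ [] → ¬ ((a ∷ p) ⊗ q) ≃ []
      lowest {[]}    _   q≄[] _ = q≄[] ≃-refl
      lowest {b ∷ q} a≉0 q≄[] e with b ≟0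
      ... | yes b≈0 = lowest a≉0 (λ q≃[] → q≄[] (∷≃[] b≈0 q≃[])) (proj₂ (∷≃[]⁻¹ (begin
        0# ∷ ((a ∷ p) ⊗ q)                          ≈⟨ ⊕-cong (≃-sym (scale-zero (a ∷ p) b≈0)) ≃-refl ⟩
        scale b (a ∷ p) ⊕ (0# ∷ ((a ∷ p) ⊗ q))      ≈⟨ ⊗-∷ʳ (a ∷ p) b q ⟨
        (a ∷ p) ⊗ (b ∷ q)                           ≈⟨ e ⟩
        []                                          ∎)))
        where open ≃-Reasoning
      ... | no b≉0 = b≉0 (cancel a≉0 (trans (sym (+-identityʳ (a * b))) (at e zero)))

    ⊗≃[]⇒≃[] : ∀ {p q} → ¬ p ≃ [] → (p ⊗ q) ≃ [] → q ≃ []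
    ⊗≃[]⇒≃[] {p} {q} p≄[] e with ≃[]? q
    ... | yes q≃[] = q≃[]
    ... | no  q≄[] = ⊥-elim (⊗≄[] p≄[] q≄[] e)

module ℚ[q] = Polynomial ℚ.+-*-commutativeRing

ℚ-cancel : ∀ {a b} → ¬ a ≡ 0ℚ → a ℚ.* b ≡ 0ℚ → b ≡ 0ℚ
ℚ-cancel {a} {b} a≢0 ab≡0 = begin
  b                   ≡⟨ ℚ.*-identityˡ b ⟨
  1ℚ ℚ.* b            ≡⟨ ≡.cong (ℚ._* b) (ℚ.*-inverseˡ a) ⟨
  (ℚ.1/ a ℚ.* a) ℚ.* b ≡⟨ ℚ.*-assoc (ℚ.1/ a) a b ⟩
  ℚ.1/ a ℚ.* (a ℚ.* b) ≡⟨ ≡.cong (ℚ.1/ a ℚ.*_) ab≡0 ⟩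
  ℚ.1/ a ℚ.* 0ℚ        ≡⟨ ℚ.*-zeroʳ (ℚ.1/ a) ⟩
  0ℚ                   ∎
  where
  open ≡.≡-Reasoning
  instance _ = ℚ.≢-nonZero a≢0

open ℚ⟮q⟯

module ℚ⟮q⟯-Properties where
  open ℚ[q] using (_≃_; ≃-refl; ≃-sym; ≃-trans; ⊕-cong; ⊗-cong; ⊗-congˡ; _⊕_; _⊗_; ⊖_)
  open ≡ using (refl)
  open CommutativeRingSolver ℚ[q].polyCommutativeRing

  ℚ[q]-⊗≄[] : ∀ {p q} → ¬ p ≃ [] → ¬ q ≃ [] → ¬ (p ℚ[q].⊗ q) ≃ []
  ℚ[q]-⊗≄[] = ℚ[q].⊗≄[] (λ a → a ℚ.≟ 0ℚ) ℚ-cancel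

  T-nonzero?⇔≄[] : ∀ {p} → T (nonzero? p) ⇔ (¬ p ≃ [])
  T-nonzero?⇔≄[] = mk⇔ to from
    where
    to : ∀ {p} → T (nonzero? p) → ¬ p ≃ []
    to {a ∷ p} t e with a ℚ.≟ 0ℚ
    ... | yes _   = to t (proj₂ (ℚ[q].∷≃[]⁻¹ e))
    ... | no a≢0 = a≢0 (proj₁ (ℚ[q].∷≃[]⁻¹ e))
    from : ∀ {p} → ¬ p ≃ [] → T (nonzero? p)
    from {[]}    p≄[] = p≄[] ≃-refl
    from {a ∷ p} p≄[] with a ℚ.≟ 0ℚ
    ... | yes a≡0 = from (λ p≃[] → p≄[] (ℚ[q].∷≃[] a≡0 p≃[]))
    ... | no  _   = tt

  den≄[] : ∀ x → ¬ den x ≃ []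
  den≄[] x = Equivalence.to T-nonzero?⇔≄[] (den≢0 x)

  den⊗den≢0 : ∀ x y → T (nonzero? (den x ℚ[q].⊗ den y))
  den⊗den≢0 x y = Equivalence.from T-nonzero?⇔≄[] (ℚ[q]-⊗≄[] (den≄[] x) (den≄[] y))

  mkF≡frac : ∀ a d (d≢0 : T (nonzero? d)) → mkF a d ≡ frac a d d≢0
  mkF≡frac a d d≢0 with T? (nonzero? d)
  ... | yes d≢0′ = ≡.cong (frac a d) (T-irrelevant d≢0′ d≢0)
  ... | no  d≡0  = ⊥-elim (d≡0 d≢0)

  num-+F : ∀ x y {a b c d} → num x ≡ a → den x ≡ b → num y ≡ c → den y ≡ d →
           num (x +F y) ≡ ((a ⊗ d) ⊕ (c ⊗ b))
  num-+F x y ≡.refl ≡.refl ≡.refl ≡.refl =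
    ≡.cong num (mkF≡frac ((num x ⊗ den y) ⊕ (num y ⊗ den x)) (den x ⊗ den y) (den⊗den≢0 x y))

  den-+F : ∀ x y {b d} → den x ≡ b → den y ≡ d → den (x +F y) ≡ (b ⊗ d)
  den-+F x y ≡.refl ≡.refl =
    ≡.cong den (mkF≡frac ((num x ⊗ den y) ⊕ (num y ⊗ den x)) (den x ⊗ den y) (den⊗den≢0 x y))

  num-*F : ∀ x y {a c} → num x ≡ a → num y ≡ c → num (x *F y) ≡ (a ⊗ c)
  num-*F x y ≡.refl ≡.refl = ≡.cong num (mkF≡frac (num x ⊗ num y) (den x ⊗ den y) (den⊗den≢0 x y))

  den-*F : ∀ x y {b d} → den x ≡ b → den y ≡ d → den (x *F y) ≡ (b ⊗ d)
  den-*F x y ≡.refl ≡.refl = ≡.cong den (mkF≡frac (num x ⊗ num y) (den x ⊗ den y) (den⊗den≢0 x y))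

  num--F : ∀ x → num (-F x) ≡ (⊖ num x)
  num--F x = ≡.cong num (mkF≡frac (⊖ num x) (den x) (den≢0 x))

  den--F : ∀ x → den (-F x) ≡ den x
  den--F x = ≡.cong den (mkF≡frac (⊖ num x) (den x) (den≢0 x))

  num-1F : num 1F ≡ (1ℚ ∷ [])
  num-1F = ≡.cong num (mkF≡frac (1ℚ ∷ []) (1ℚ ∷ []) tt)

  den-1F : den 1F ≡ (1ℚ ∷ [])
  den-1F = ≡.cong den (mkF≡frac (1ℚ ∷ []) (1ℚ ∷ []) tt)

  cross-≈F : ∀ x y {a b c d} → num x ≡ a → den x ≡ b → num y ≡ c → den y ≡ d →
             (a ⊗ d) ≃ (c ⊗ b) → x ≈F y
  cross-≈F x y ≡.refl ≡.refl ≡.refl ≡.refl = Equivalence.from ℚ[q].≋⇔≃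

  ≈F⇒cross : ∀ x y → x ≈F y → (num x ⊗ den y) ≃ (num y ⊗ den x)
  ≈F⇒cross x y = Equivalence.to ℚ[q].≋⇔≃

  ≈F-refl : ∀ {x} → x ≈F x
  ≈F-refl {x} = cross-≈F x x refl refl refl refl ≃-refl

  ≈F-sym : ∀ {x y} → x ≈F y → y ≈F x
  ≈F-sym {x} {y} e = cross-≈F y x refl refl refl refl (≃-sym (≈F⇒cross x y e))

  -- The cross product for x, z times den y is a combination of those for x, y and y, z; then cancel den y ≠ 0.
  ≈F-trans : ∀ {x y z} → x ≈F y → y ≈F z → x ≈F z
  ≈F-trans {x} {y} {z} x≈y y≈z = cross-≈F x z refl refl refl refl
    (Equivalence.to ℚ[q].≋⇔≃ (Equivalence.from ℚ[q].IsZero⇔≃[]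
      (ℚ[q].⊗≃[]⇒≃[] (λ a → a ℚ.≟ 0ℚ) ℚ-cancel (den≄[] y) dy⊗[cross]≃[])))
    where
    dy⊗[cross]≃[] : (den y ⊗ ((num x ⊗ den z) ⊕ (⊖ (num z ⊗ den x)))) ≃ []
    dy⊗[cross]≃[] = ≃-trans
      (solve 5 (λ nx dx dy nz dz → dy :* (nx :* dz :- nz :* dx) := (nx :* dy) :* dz :- (nz :* dy) :* dx)
             ≃-refl (num x) (den x) (den y) (num z) (den z))
      (≃-trans (⊕-cong (⊗-congˡ (den z) (≈F⇒cross x y x≈y)) (ℚ[q].⊖-cong (⊗-congˡ (den x) (≃-sym (≈F⇒cross y z y≈z)))))
        (solve 3 (λ ny dx dz → (ny :* dx) :* dz :- (ny :* dz) :* dx := con (+ 0)) ≃-refl (num y) (den x) (den z)))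

  +F-cong : ∀ {x x′ y y′} → x ≈F x′ → y ≈F y′ → (x +F y) ≈F (x′ +F y′)
  +F-cong {x} {x′} {y} {y′} x≈x′ y≈y′ =
    cross-≈F (x +F y) (x′ +F y′) (num-+F x y refl refl refl refl) (den-+F x y refl refl) (num-+F x′ y′ refl refl refl refl) (den-+F x′ y′ refl refl)
      (≃-trans (solve 8 (λ nx dx ny dy nx′ dx′ ny′ dy′ →
                  (nx :* dy :+ ny :* dx) :* (dx′ :* dy′) := (nx :* dx′) :* (dy :* dy′) :+ (ny :* dy′) :* (dx :* dx′))
                ≃-refl (num x) (den x) (num y) (den y) (num x′) (den x′) (num y′) (den y′))
      (≃-trans (⊕-cong (⊗-congˡ (den y ⊗ den y′) (≈F⇒cross x x′ x≈x′)) (⊗-congˡ (den x ⊗ den x′) (≈F⇒cross y y′ y≈y′)))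
        (solve 8 (λ nx dx ny dy nx′ dx′ ny′ dy′ →
                  (nx′ :* dx) :* (dy :* dy′) :+ (ny′ :* dy) :* (dx :* dx′) := (nx′ :* dy′ :+ ny′ :* dx′) :* (dx :* dy))
                ≃-refl (num x) (den x) (num y) (den y) (num x′) (den x′) (num y′) (den y′))))

  *F-cong : ∀ {x x′ y y′} → x ≈F x′ → y ≈F y′ → (x *F y) ≈F (x′ *F y′)
  *F-cong {x} {x′} {y} {y′} x≈x′ y≈y′ =
    cross-≈F (x *F y) (x′ *F y′) (num-*F x y refl refl) (den-*F x y refl refl) (num-*F x′ y′ refl refl) (den-*F x′ y′ refl refl)
      (≃-trans (solve 8 (λ nx dx ny dy nx′ dx′ ny′ dy′ →
                  (nx :* ny) :* (dx′ :* dy′) := (nx :* dx′) :* (ny :* dy′)) ≃-refl (num x) (den x) (num y) (den y) (num x′) (den x′) (num y′) (den y′))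
      (≃-trans (⊗-cong (≈F⇒cross x x′ x≈x′) (≈F⇒cross y y′ y≈y′))
        (solve 8 (λ nx dx ny dy nx′ dx′ ny′ dy′ →
                  (nx′ :* dx) :* (ny′ :* dy) := (nx′ :* ny′) :* (dx :* dy)) ≃-refl (num x) (den x) (num y) (den y) (num x′) (den x′) (num y′) (den y′))))

  -F-cong : ∀ {x x′} → x ≈F x′ → (-F x) ≈F (-F x′)
  -F-cong {x} {x′} x≈x′ = cross-≈F (-F x) (-F x′) (num--F x) (den--F x) (num--F x′) (den--F x′)
    (≃-trans (solve 2 (λ nx dx′ → (:- nx) :* dx′ := :- (nx :* dx′)) ≃-refl (num x) (den x′))
    (≃-trans (ℚ[q].⊖-cong (≈F⇒cross x x′ x≈x′))
      (solve 2 (λ nx′ dx → :- (nx′ :* dx) := (:- nx′) :* dx) ≃-refl (num x′) (den x))))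

  module _ (x y z : ℚ⟮q⟯) where
    +F-assoc : ((x +F y) +F z) ≈F (x +F (y +F z))
    +F-assoc = cross-≈F ((x +F y) +F z) (x +F (y +F z))
      (num-+F (x +F y) z (num-+F x y refl refl refl refl) (den-+F x y refl refl) refl refl) (den-+F (x +F y) z (den-+F x y refl refl) refl)
      (num-+F x (y +F z) refl refl (num-+F y z refl refl refl refl) (den-+F y z refl refl)) (den-+F x (y +F z) refl (den-+F y z refl refl))
      (solve 6 (λ nx dx ny dy nz dz →
          ((nx :* dy :+ ny :* dx) :* dz :+ nz :* (dx :* dy)) :* (dx :* (dy :* dz))
       := (nx :* (dy :* dz) :+ (ny :* dz :+ nz :* dy) :* dx) :* ((dx :* dy) :* dz)) ≃-refl (num x) (den x) (num y) (den y) (num z) (den z))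

    *F-assoc : ((x *F y) *F z) ≈F (x *F (y *F z))
    *F-assoc = cross-≈F ((x *F y) *F z) (x *F (y *F z))
      (num-*F (x *F y) z (num-*F x y refl refl) refl) (den-*F (x *F y) z (den-*F x y refl refl) refl)
      (num-*F x (y *F z) refl (num-*F y z refl refl)) (den-*F x (y *F z) refl (den-*F y z refl refl))
      (solve 6 (λ nx dx ny dy nz dz →
          ((nx :* ny) :* nz) :* (dx :* (dy :* dz)) := (nx :* (ny :* nz)) :* ((dx :* dy) :* dz))
        ≃-refl (num x) (den x) (num y) (den y) (num z) (den z))

    *F-distribˡ-+F : (x *F (y +F z)) ≈F ((x *F y) +F (x *F z))
    *F-distribˡ-+F = cross-≈F (x *F (y +F z)) ((x *F y) +F (x *F z))
      (num-*F x (y +F z) refl (num-+F y z refl refl refl refl)) (den-*F x (y +F z) refl (den-+F y z refl refl))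
      (num-+F (x *F y) (x *F z) (num-*F x y refl refl) (den-*F x y refl refl) (num-*F x z refl refl) (den-*F x z refl refl))
      (den-+F (x *F y) (x *F z) (den-*F x y refl refl) (den-*F x z refl refl))
      (solve 6 (λ nx dx ny dy nz dz →
          (nx :* (ny :* dz :+ nz :* dy)) :* ((dx :* dy) :* (dx :* dz))
       := ((nx :* ny) :* (dx :* dz) :+ (nx :* nz) :* (dx :* dy)) :* (dx :* (dy :* dz))) ≃-refl (num x) (den x) (num y) (den y) (num z) (den z))

  module _ (x y : ℚ⟮q⟯) where
    +F-comm : (x +F y) ≈F (y +F x)
    +F-comm = cross-≈F (x +F y) (y +F x) (num-+F x y refl refl refl refl) (den-+F x y refl refl) (num-+F y x refl refl refl refl) (den-+F y x refl refl)
      (solve 4 (λ nx dx ny dy → (nx :* dy :+ ny :* dx) :* (dy :* dx) := (ny :* dx :+ nx :* dy) :* (dx :* dy))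
        ≃-refl (num x) (den x) (num y) (den y))

    *F-comm : (x *F y) ≈F (y *F x)
    *F-comm = cross-≈F (x *F y) (y *F x) (num-*F x y refl refl) (den-*F x y refl refl) (num-*F y x refl refl) (den-*F y x refl refl)
      (solve 4 (λ nx dx ny dy → (nx :* ny) :* (dy :* dx) := (ny :* nx) :* (dx :* dy)) ≃-refl (num x) (den x) (num y) (den y))

  module _ (x : ℚ⟮q⟯) where
    +F-identityˡ : (0F +F x) ≈F x
    +F-identityˡ = cross-≈F (0F +F x) x (num-+F 0F x refl refl refl refl) (den-+F 0F x refl refl) refl refl
      (solve 2 (λ nx dx → (con (+ 0) :* dx :+ nx :* con (+ 1)) :* dx := nx :* (con (+ 1) :* dx)) ≃-refl (num x) (den x))

    -F-inverseˡ : ((-F x) +F x) ≈F 0F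
    -F-inverseˡ = cross-≈F ((-F x) +F x) 0F (num-+F (-F x) x (num--F x) (den--F x) refl refl) (den-+F (-F x) x (den--F x) refl) refl refl
      (solve 2 (λ nx dx → ((:- nx) :* dx :+ nx :* dx) :* con (+ 1) := con (+ 0) :* (dx :* dx)) ≃-refl (num x) (den x))

    *F-identityˡ : (1F *F x) ≈F x
    *F-identityˡ = cross-≈F (1F *F x) x (num-*F 1F x num-1F refl) (den-*F 1F x den-1F refl) refl refl
      (solve 2 (λ nx dx → (con (+ 1) :* nx) :* dx := nx :* (con (+ 1) :* dx)) ≃-refl (num x) (den x))

ℚ⟮q⟯-commutativeRing : CommutativeRing 0ℓ 0ℓ
ℚ⟮q⟯-commutativeRing = record
  { Carrier = ℚ⟮q⟯ ; _≈_ = _≈F_ ; _+_ = _+F_ ; _*_ = _*F_ ; -_ = -F_ ; 0# = 0F ; 1# = 1F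
  ; isCommutativeRing = record
    { isRing = record
      { +-isAbelianGroup = record
        { isGroup = record
          { isMonoid = record
            { isSemigroup = record
              { isMagma = record
                { isEquivalence = record { refl = λ {x} → ≈F-refl {x} ; sym = λ {x} {y} → ≈F-sym {x} {y}
                                         ; trans = λ {x} {y} {z} → ≈F-trans {x} {y} {z} }
                ; ∙-cong = λ {x} {x′} {y} {y′} → +F-cong {x} {x′} {y} {y′} }
              ; assoc = +F-assoc }
            ; identity = +F-identityˡ , λ x → ≈F-trans {x +F 0F} {0F +F x} {x} (+F-comm x 0F) (+F-identityˡ x) }
          ; inverse = -F-inverseˡ , λ x → ≈F-trans {x +F (-F x)} {(-F x) +F x} {0F} (+F-comm x (-F x)) (-F-inverseˡ x)
          ; ⁻¹-cong = λ {x} {x′} → -F-cong {x} {x′} }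
        ; comm = +F-comm }
      ; *-cong = λ {x} {x′} {y} {y′} → *F-cong {x} {x′} {y} {y′}
      ; *-assoc = *F-assoc
      ; *-identity = *F-identityˡ , λ x → ≈F-trans {x *F 1F} {1F *F x} {x} (*F-comm x 1F) (*F-identityˡ x)
      ; distrib = *F-distribˡ-+F , λ x y z →
          ≈F-trans {(y +F z) *F x} {x *F (y +F z)} {(y *F x) +F (z *F x)} (*F-comm (y +F z) x)
            (≈F-trans {x *F (y +F z)} {(x *F y) +F (x *F z)} {(y *F x) +F (z *F x)} (*F-distribˡ-+F x y z)
              (+F-cong {x *F y} {y *F x} {x *F z} {z *F x} (*F-comm x y) (*F-comm x z))) }
    ; *-comm = *F-comm } }
  where open ℚ⟮q⟯-Properties

module ℚ⟮q⟯-Field where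
  open ℚ⟮q⟯-Properties
  open ℚ[q] using (_≃_; ≃-refl; ≃-sym; ≃-trans; _⊗_; one; coeff; at; ⊗-identityʳ; ⊗-identityˡ; X⊗)
  open ≡ using (refl)

  ≈F0⇔num≃[] : ∀ x → x ≈F 0F ⇔ num x ≃ []
  ≈F0⇔num≃[] x = mk⇔
    (λ x≈0 → ≃-trans (≃-sym (⊗-identityʳ (num x))) (≈F⇒cross x 0F x≈0))
    (λ num≃[] → cross-≈F x 0F refl refl refl refl (≃-trans (⊗-identityʳ (num x)) num≃[]))

  invF-inverseˡ : ∀ x → ¬ x ≈F 0F → (invF x *F x) ≈F 1F
  invF-inverseˡ x x≉0 = cross-≈F (invF x *F x) 1F (num-*F (invF x) x num-invF refl) (den-*F (invF x) x den-invF refl) num-1F den-1F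
    (solve 2 (λ nx dx → (dx :* nx) :* con (+ 1) := con (+ 1) :* (nx :* dx)) ≃-refl (num x) (den x))
    where
    open CommutativeRingSolver ℚ[q].polyCommutativeRing
    num≢0 : T (nonzero? (num x))
    num≢0 = Equivalence.from T-nonzero?⇔≄[] (λ num≃[] → x≉0 (Equivalence.from (≈F0⇔num≃[] x) num≃[]))
    num-invF : num (invF x) ≡ den x
    num-invF = ≡.cong num (mkF≡frac (den x) (num x) num≢0)
    den-invF : den (invF x) ≡ num x
    den-invF = ≡.cong den (mkF≡frac (den x) (num x) num≢0)

  monomial : ℕ → List ℚ
  monomial zero    = 1ℚ ∷ []
  monomial (suc m) = 0ℚ ∷ monomial m

  q^F≈monomial : ∀ m → (qF ^F m) ≈F frac (monomial m) (1ℚ ∷ []) tt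
  q^F≈monomial zero    = cross-≈F 1F (frac (monomial 0) (1ℚ ∷ []) tt) num-1F den-1F refl refl ≃-refl
  q^F≈monomial (suc m) = ≈F-trans {qF *F (qF ^F m)} {qF *F qᵐ} {frac (monomial (suc m)) (1ℚ ∷ []) tt}
    (*F-cong {qF} {qF} {qF ^F m} {qᵐ} (≈F-refl {qF}) (q^F≈monomial m))
    (cross-≈F (qF *F qᵐ) (frac (monomial (suc m)) (1ℚ ∷ []) tt)
      (num-*F qF qᵐ (≡.cong num (mkF≡frac X one tt)) refl) (den-*F qF qᵐ (≡.cong den (mkF≡frac X one tt)) refl) refl refl
      (≃-trans (⊗-identityʳ (X ⊗ monomial m))
        (≃-trans (X⊗ (monomial m)) (≃-sym (≃-trans (ℚ[q].⊗-congʳ (monomial (suc m)) (⊗-identityˡ one)) (⊗-identityʳ _))))))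
    where
    open ℚ[q] using (X)
    qᵐ : ℚ⟮q⟯
    qᵐ = frac (monomial m) (1ℚ ∷ []) tt

  coeff-monomial-self : ∀ a → coeff (monomial a) a ≡ 1ℚ
  coeff-monomial-self zero    = refl
  coeff-monomial-self (suc a) = coeff-monomial-self a

  coeff-monomial-other : ∀ {a b} → ¬ a ≡ b → coeff (monomial b) a ≡ 0ℚ
  coeff-monomial-other {zero}  {zero}  a≢b = ⊥-elim (a≢b refl)
  coeff-monomial-other {zero}  {suc b} a≢b = refl
  coeff-monomial-other {suc a} {zero}  a≢b = refl
  coeff-monomial-other {suc a} {suc b} a≢b = coeff-monomial-other (λ a≡b → a≢b (≡.cong suc a≡b))

  q^F-injective : ∀ a b → (qF ^F a) ≈F (qF ^F b) → a ≡ b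
  q^F-injective a b qᵃ≈qᵇ with a ℕ.≟ b
  ... | yes a≡b = a≡b
  ... | no  a≢b = ⊥-elim (ℚ.1≢0 (begin
    1ℚ                       ≡⟨ coeff-monomial-self a ⟨
    coeff (monomial a) a     ≡⟨ at monomialᵃ≃monomialᵇ a ⟩
    coeff (monomial b) a     ≡⟨ coeff-monomial-other a≢b ⟩
    0ℚ                       ∎))
    where
    open ≡.≡-Reasoning
    qᵃ qᵇ : ℚ⟮q⟯
    qᵃ = frac (monomial a) (1ℚ ∷ []) tt
    qᵇ = frac (monomial b) (1ℚ ∷ []) tt
    qᵃ≈qᵇ′ : qᵃ ≈F qᵇ
    qᵃ≈qᵇ′ = ≈F-trans {qᵃ} {qF ^F a} {qᵇ} (≈F-sym {qF ^F a} {qᵃ} (q^F≈monomial a))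
                (≈F-trans {qF ^F a} {qF ^F b} {qᵇ} qᵃ≈qᵇ (q^F≈monomial b))
    monomialᵃ≃monomialᵇ : monomial a ≃ monomial b
    monomialᵃ≃monomialᵇ = ≃-trans (≃-sym (⊗-identityʳ (monomial a)))
                            (≃-trans (≈F⇒cross qᵃ qᵇ qᵃ≈qᵇ′) (⊗-identityʳ (monomial b)))

⌊fsuc≟fsuc⌋ : ∀ {N} (i t : Fin N) → ⌊ fsuc i ≟ᶠ fsuc t ⌋ ≡ ⌊ i ≟ᶠ t ⌋
⌊fsuc≟fsuc⌋ i t with i ≟ᶠ t
... | yes _ = ≡.refl
... | no  _ = ≡.refl

module LaurentCriterion (K : CommutativeRing 0ℓ 0ℓ) where
  open CommutativeRing K hiding (zero)
  open Algebra.Definitions.RawSemiring (Semiring.rawSemiring semiring) using (_^_; sum; product)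
  open Polynomial K
  open import Algebra.Properties.Semiring.Exp semiring using (^-congˡ; ^-homo-*)
  open import Algebra.Properties.Semiring.Sum semiring using (sum-cong-≋; *-distribˡ-sum)
  open import Algebra.Properties.Ring ring using (x∙y⁻¹≈ε⇒x≈y)
  private module Product = Algebra.Properties.Monoid.Sum *-monoid
  open CommutativeRingSolver K
  open Relation.Binary.Reasoning.Setoid setoid

  product-^-split : ∀ {N} (f : Fin N → Carrier) (t : Fin N) {a b} → b ℕ.≤ a →
    product (λ i → f i ^ (if ⌊ i ≟ᶠ t ⌋ then a ∸ b else a)) * f t ^ b ≈ product (λ i → f i ^ a)
  product-^-split {suc N} f fzero {a} {b} b≤a = begin
    (f fzero ^ (a ∸ b) * P) * f fzero ^ b   ≈⟨ solve 3 (λ x y z → (x :* y) :* z := (x :* z) :* y) refl _ P _ ⟩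
    (f fzero ^ (a ∸ b) * f fzero ^ b) * P   ≈⟨ *-congʳ (^-homo-* (f fzero) (a ∸ b) b) ⟨
    f fzero ^ (a ∸ b ℕ.+ b) * P              ≡⟨ ≡.cong (λ e → f fzero ^ e * P) (ℕ.m∸n+n≡m b≤a) ⟩
    f fzero ^ a * P                          ∎
    where
    P : Carrier
    P = product (λ i → f (fsuc i) ^ a)
  product-^-split {suc N} f (fsuc t) {a} {b} b≤a = begin
    (f fzero ^ a * P′) * f (fsuc t) ^ b     ≈⟨ *-congʳ (*-congˡ (Product.sum-cong-≋ λ i →
                                                 reflexive (≡.cong (λ c → f (fsuc i) ^ (if c then a ∸ b else a))
                                                                    (⌊fsuc≟fsuc⌋ i t)))) ⟩
    (f fzero ^ a * P) * f (fsuc t) ^ b      ≈⟨ *-assoc _ _ _ ⟩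
    f fzero ^ a * (P * f (fsuc t) ^ b)      ≈⟨ *-congˡ (product-^-split (f ∘ fsuc) t b≤a) ⟩
    f fzero ^ a * product (λ i → f (fsuc i) ^ a) ∎
    where
    P′ P : Carrier
    P′ = product (λ i → f (fsuc i) ^ (if ⌊ fsuc i ≟ᶠ fsuc t ⌋ then a ∸ b else a))
    P  = product (λ i → f (fsuc i) ^ (if ⌊ i ≟ᶠ t ⌋ then a ∸ b else a))

  -- q^-injective says that q is neither zero nor a root of unity.
  module Field (_⁻¹ : Carrier → Carrier) (⁻¹-inverseˡ : ∀ x → ¬ x ≈ 0# → (x ⁻¹) * x ≈ 1#)
               (q : Carrier) (q^-injective : ∀ a b → q ^ a ≈ q ^ b → a ≡ b) where

    x*y≈0⇒y≈0 : ∀ {x y} → ¬ x ≈ 0# → x * y ≈ 0# → y ≈ 0#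
    x*y≈0⇒y≈0 {x} {y} x≉0 xy≈0 = begin
      y                ≈⟨ *-identityˡ y ⟨
      1# * y           ≈⟨ *-congʳ (⁻¹-inverseˡ x x≉0) ⟨
      (x ⁻¹ * x) * y   ≈⟨ *-assoc _ _ _ ⟩
      x ⁻¹ * (x * y)   ≈⟨ *-congˡ xy≈0 ⟩
      x ⁻¹ * 0#        ≈⟨ zeroʳ _ ⟩
      0#               ∎

    *-≉0 : ∀ {x y} → ¬ x ≈ 0# → ¬ y ≈ 0# → ¬ x * y ≈ 0#
    *-≉0 x≉0 y≉0 xy≈0 = y≉0 (x*y≈0⇒y≈0 x≉0 xy≈0)

    q^[1+m]≉0 : ∀ m → ¬ q ^ suc m ≈ 0#
    q^[1+m]≉0 m qᵐ⁺¹≈0 = ℕ.1+n≢n (q^-injective (suc (suc m)) (suc m) (begin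
      q * q ^ suc m  ≈⟨ *-congˡ qᵐ⁺¹≈0 ⟩
      q * 0#         ≈⟨ zeroʳ q ⟩
      0#             ≈⟨ qᵐ⁺¹≈0 ⟨
      q ^ suc m      ∎))

    1≉0 : ¬ 1# ≈ 0#
    1≉0 1≈0 = q^[1+m]≉0 0 (trans (*-congˡ 1≈0) (zeroʳ q))

    1-q^[1+m]≉0 : ∀ m → ¬ 1# - q ^ suc m ≈ 0#
    1-q^[1+m]≉0 m e = ℕ.0≢1+n (q^-injective 0 (suc m) (x∙y⁻¹≈ε⇒x≈y 1# (q ^ suc m) e))

    ^-≉0 : ∀ {x} m → ¬ x ≈ 0# → ¬ x ^ m ≈ 0#
    ^-≉0 zero    x≉0 = 1≉0
    ^-≉0 (suc m) x≉0 = *-≉0 x≉0 (^-≉0 m x≉0)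

    product-≉0 : ∀ {m} (f : Fin m → Carrier) → (∀ i → ¬ f i ≈ 0#) → ¬ product f ≈ 0#
    product-≉0 {zero}  f f≉0 = 1≉0
    product-≉0 {suc m} f f≉0 = *-≉0 (f≉0 fzero) (product-≉0 (f ∘ fsuc) (f≉0 ∘ fsuc))

    exponent : ∀ {n} (A : ℕ) → Fin A → (t i : Fin (suc n)) → ℕ
    exponent A j t i = if ⌊ i ≟ᶠ t ⌋ then A ∸ suc (toℕ j) else A

    -- Πpoly of Defs, with an arbitrary K in place of ℚ(q).
    Π : (A n : ℕ) → (Fin A → Fin (suc n) → Carrier) → Poly
    Π A n p = ∑ λ j → ∑ λ t → C (q ^ toℕ t * p j t) ⊗ ∏ λ i → 1-[ q ^ toℕ i ]X ^ₚ exponent A j t i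

    -- The coefficient of z^(-m) in Li_J(1/z; q).
    li : ℕ → ℕ → Carrier
    li J m = q ^ m * ((1# - q ^ m) ^ J) ⁻¹

    -- The coefficient of z^(-(k+1)) in ∑_j P_j(z) Li_j(1/z; q).
    negCoeff : (A n : ℕ) → (Fin A → Fin (suc n) → Carrier) → ℕ → Carrier
    negCoeff A n p k = sum λ j → sum λ t → p j t * li (suc (toℕ j)) (suc (toℕ t ℕ.+ k))

    module _ (A n : ℕ) (p : Fin A → Fin (suc n) → Carrier) (k : ℕ) where
      private
        x : Carrier
        x = q ^ suc k
        f : Fin (suc n) → Carrier
        f i = 1# - q ^ suc (toℕ i ℕ.+ k)
        D : Carrier
        D = product λ i → f i ^ A

      q^i*x≈q^[1+i+k] : ∀ i → q ^ i * x ≈ q ^ suc (i ℕ.+ k)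
      q^i*x≈q^[1+i+k] i = trans (sym (^-homo-* q i (suc k))) (reflexive (≡.cong (q ^_) (ℕ.+-suc i k)))

      eval-Π : eval (Π A n p) x ≈ sum λ j → sum λ t → (q ^ toℕ t * p j t) * product λ i → f i ^ exponent A j t i
      eval-Π = trans (eval-∑ (λ j → ∑ (term j)) x) (sum-cong-≋ λ j → trans (eval-∑ (term j) x) (sum-cong-≋ λ t →
        trans (eval-⊗ (C (q ^ toℕ t * p j t)) (∏ (factor j t)) x)
              (*-cong (eval-C _ x) (trans (eval-∏ (factor j t) x) (Product.sum-cong-≋ λ i →
                trans (eval-^ 1-[ q ^ toℕ i ]X (exponent A j t i) x)
                      (^-congˡ (exponent A j t i) (trans (eval-1-[c]X (q ^ toℕ i) x)
                                                         (+-congˡ (-‿cong (q^i*x≈q^[1+i+k] (toℕ i)))))))))))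
        where
        factor : Fin A → (t i : Fin (suc n)) → Poly
        factor j t i = 1-[ q ^ toℕ i ]X ^ₚ exponent A j t i
        term : Fin A → Fin (suc n) → Poly
        term j t = C (q ^ toℕ t * p j t) ⊗ ∏ (factor j t)

      -- D contains f_t^(j+1), which cancels against the inverse in li.
      term-identity : ∀ j t → x * ((q ^ toℕ t * p j t) * product (λ i → f i ^ exponent A j t i))
                              ≈ D * (p j t * li (suc (toℕ j)) (suc (toℕ t ℕ.+ k)))
      term-identity j t = sym (begin
        D * (p j t * (qᵗ⁺ᵏ⁺¹ * g ⁻¹))        ≈⟨ *-congʳ (product-^-split f t (toℕ<n j)) ⟨
        (P * g) * (p j t * (qᵗ⁺ᵏ⁺¹ * g ⁻¹))  ≈⟨ *-congˡ (*-congˡ (*-congʳ (q^i*x≈q^[1+i+k] (toℕ t)))) ⟨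
        (P * g) * (p j t * ((q ^ toℕ t * x) * g ⁻¹))
          ≈⟨ solve 6 (λ P g p qᵗ x g⁻¹ → (P :* g) :* (p :* ((qᵗ :* x) :* g⁻¹)) := (x :* ((qᵗ :* p) :* P)) :* (g⁻¹ :* g))
                   refl P g (p j t) (q ^ toℕ t) x (g ⁻¹) ⟩
        (x * ((q ^ toℕ t * p j t) * P)) * (g ⁻¹ * g)
          ≈⟨ *-congˡ (⁻¹-inverseˡ g (^-≉0 (suc (toℕ j)) (1-q^[1+m]≉0 (toℕ t ℕ.+ k)))) ⟩
        (x * ((q ^ toℕ t * p j t) * P)) * 1#  ≈⟨ *-identityʳ _ ⟩
        x * ((q ^ toℕ t * p j t) * P)        ∎)
        where
        P qᵗ⁺ᵏ⁺¹ g : Carrier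
        P = product (λ i → f i ^ exponent A j t i)
        qᵗ⁺ᵏ⁺¹ = q ^ suc (toℕ t ℕ.+ k)
        g = (1# - qᵗ⁺ᵏ⁺¹) ^ suc (toℕ j)

      x*Π[x]≈D*negCoeff : x * eval (Π A n p) x ≈ D * negCoeff A n p k
      x*Π[x]≈D*negCoeff = begin
        x * eval (Π A n p) x                     ≈⟨ *-congˡ eval-Π ⟩
        x * sum (λ j → sum (λ t → Term j t))     ≈⟨ *-distribˡ-sum x (λ j → sum (Term j)) ⟩
        sum (λ j → x * sum (λ t → Term j t))     ≈⟨ sum-cong-≋ (λ j → trans (*-distribˡ-sum x (Term j))
                                                                           (sum-cong-≋ (term-identity j))) ⟩
        sum (λ j → sum (λ t → D * Summand j t))  ≈⟨ sum-cong-≋ (λ j → *-distribˡ-sum D (Summand j)) ⟨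
        sum (λ j → D * sum (λ t → Summand j t))  ≈⟨ *-distribˡ-sum D (λ j → sum (Summand j)) ⟨
        D * negCoeff A n p k                     ∎
        where
        Term : Fin A → Fin (suc n) → Carrier
        Term j t = (q ^ toℕ t * p j t) * product (λ i → f i ^ exponent A j t i)
        Summand : Fin A → Fin (suc n) → Carrier
        Summand j t = p j t * li (suc (toℕ j)) (suc (toℕ t ℕ.+ k))

      Π[q^[1+k]]≈0⇔negCoeff≈0 : eval (Π A n p) x ≈ 0# ⇔ negCoeff A n p k ≈ 0#
      Π[q^[1+k]]≈0⇔negCoeff≈0 = mk⇔
        (λ Π[x]≈0 → x*y≈0⇒y≈0 D≉0 (trans (sym x*Π[x]≈D*negCoeff) (trans (*-congˡ Π[x]≈0) (zeroʳ x))))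
        (λ negCoeff≈0 → x*y≈0⇒y≈0 (q^[1+m]≉0 k) (trans x*Π[x]≈D*negCoeff (trans (*-congˡ negCoeff≈0) (zeroʳ D))))
        where
        D≉0 : ¬ D ≈ 0#
        D≉0 = product-≉0 (λ i → f i ^ A) λ i → ^-≉0 A (1-q^[1+m]≉0 (toℕ i ℕ.+ k))

    q≉0 : ¬ q ≈ 0#
    q≉0 q≈0 = q^[1+m]≉0 0 (trans (*-congʳ q≈0) (zeroˡ _))

    q⁻¹^m*q^m≈1 : ∀ m → (q ⁻¹) ^ m * q ^ m ≈ 1#
    q⁻¹^m*q^m≈1 zero    = *-identityˡ 1#
    q⁻¹^m*q^m≈1 (suc m) = begin
      (q ⁻¹ * (q ⁻¹) ^ m) * (q * q ^ m)   ≈⟨ solve 4 (λ u uᵐ q qᵐ → (u :* uᵐ) :* (q :* qᵐ) := (u :* q) :* (uᵐ :* qᵐ)) refl _ _ q _ ⟩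
      (q ⁻¹ * q) * ((q ⁻¹) ^ m * q ^ m)   ≈⟨ *-cong (⁻¹-inverseˡ q q≉0) (q⁻¹^m*q^m≈1 m) ⟩
      1# * 1#                             ≈⟨ *-identityˡ 1# ⟩
      1#                                  ∎

    -- The q-Pochhammer symbol (s q^(-ρ); q)_ρ = ∏_{i<ρ} (1 - q^(-ρ) q^i s) and its roots q^(ρ-i).
    module _ (ρ : ℕ) where
      pochhammerCoeff : ℕ → Carrier
      pochhammerCoeff i = (q ⁻¹) ^ ρ * q ^ i

      pochhammerRoot : ℕ → Carrier
      pochhammerRoot i = q ^ ρ * (q ⁻¹) ^ i

      pochhammerCoeff*root : ∀ i j → pochhammerCoeff j * pochhammerRoot i ≈ (q ⁻¹) ^ i * q ^ j
      pochhammerCoeff*root i j = begin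
        ((q ⁻¹) ^ ρ * q ^ j) * (q ^ ρ * (q ⁻¹) ^ i)    ≈⟨ solve 4 (λ uᵖ qʲ qᵖ uⁱ → (uᵖ :* qʲ) :* (qᵖ :* uⁱ) := (uᵖ :* qᵖ) :* (uⁱ :* qʲ))
                                                            refl _ _ _ _ ⟩
        ((q ⁻¹) ^ ρ * q ^ ρ) * ((q ⁻¹) ^ i * q ^ j)    ≈⟨ *-congʳ (q⁻¹^m*q^m≈1 ρ) ⟩
        1# * ((q ⁻¹) ^ i * q ^ j)                      ≈⟨ *-identityˡ _ ⟩
        (q ⁻¹) ^ i * q ^ j                             ∎

      pochhammerCoeff*root≈1 : ∀ i → pochhammerCoeff i * pochhammerRoot i ≈ 1#
      pochhammerCoeff*root≈1 i = trans (pochhammerCoeff*root i i) (q⁻¹^m*q^m≈1 i)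

      pochhammerCoeff*root≉1 : ∀ {i j} → j ℕ.< i → ¬ pochhammerCoeff j * pochhammerRoot i ≈ 1#
      pochhammerCoeff*root≉1 {i} {j} j<i e = ℕ.<⇒≢ j<i (q^-injective j i (begin
        q ^ j                              ≈⟨ *-identityˡ _ ⟨
        1# * q ^ j                         ≈⟨ *-congʳ (q⁻¹^m*q^m≈1 i) ⟨
        ((q ⁻¹) ^ i * q ^ i) * q ^ j       ≈⟨ solve 3 (λ uⁱ qⁱ qʲ → (uⁱ :* qⁱ) :* qʲ := qⁱ :* (uⁱ :* qʲ)) refl _ _ _ ⟩
        q ^ i * ((q ⁻¹) ^ i * q ^ j)       ≈⟨ *-congˡ (trans (sym (pochhammerCoeff*root i j)) e) ⟩
        q ^ i * 1#                         ≈⟨ *-identityʳ _ ⟩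
        q ^ i                              ∎))

      pochhammerRoot≈q^[1+k] : ∀ {i k} → suc k ℕ.+ i ≡ ρ → pochhammerRoot i ≈ q ^ suc k
      pochhammerRoot≈q^[1+k] {i} {k} k+i≡ρ = begin
        q ^ ρ * (q ⁻¹) ^ i                 ≡⟨ ≡.cong (λ e → q ^ e * (q ⁻¹) ^ i) k+i≡ρ ⟨
        q ^ (suc k ℕ.+ i) * (q ⁻¹) ^ i     ≈⟨ *-congʳ (^-homo-* q (suc k) i) ⟩
        (q ^ suc k * q ^ i) * (q ⁻¹) ^ i   ≈⟨ solve 3 (λ a b c → (a :* b) :* c := a :* (c :* b)) refl _ _ _ ⟩
        q ^ suc k * ((q ⁻¹) ^ i * q ^ i)   ≈⟨ *-congˡ (q⁻¹^m*q^m≈1 i) ⟩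
        q ^ suc k * 1#                     ≈⟨ *-identityʳ _ ⟩
        q ^ suc k                          ∎

    -- The roots q^(ρ-i), 0 ≤ i < ρ, of the Pochhammer symbol are the points q^(k+1), 0 ≤ k < ρ.
    pochhammer∣Π⇔negCoeff≈0 : ∀ A n p ρ →
      linearFactors (pochhammerCoeff ρ) ρ ∣ Π A n p ⇔ (∀ {k} → k ℕ.< ρ → negCoeff A n p k ≈ 0#)
    pochhammer∣Π⇔negCoeff≈0 A n p ρ =
      mk⇔ (λ ∣Π {k} k<ρ → Equivalence.to (Π[q^[1+k]]≈0⇔negCoeff≈0 A n p k)
                            (trans (eval-congʳ (Π A n p) (sym (pochhammerRoot≈q^[1+k] ρ {ρ ∸ suc k} {k} (ℕ.m+[n∸m]≡n k<ρ))))
                                   (Equivalence.to roots⇔ ∣Π (ℕ.∸-monoʳ-< {o = 0} ℕ.z<s k<ρ))))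
          (λ negCoeff≈0 → Equivalence.from roots⇔ λ {i} i<ρ →
            trans (eval-congʳ (Π A n p) (pochhammerRoot≈q^[1+k] ρ {i} {ρ ∸ suc i} (complement i<ρ)))
                  (Equivalence.from (Π[q^[1+k]]≈0⇔negCoeff≈0 A n p (ρ ∸ suc i))
                                    (negCoeff≈0 (ℕ.∸-monoʳ-< {o = 0} ℕ.z<s i<ρ))))
      where
      roots⇔ : linearFactors (pochhammerCoeff ρ) ρ ∣ Π A n p ⇔ (∀ {i} → i ℕ.< ρ → eval (Π A n p) (pochhammerRoot ρ i) ≈ 0#)
      roots⇔ = linearFactors∣⇔roots 1≉0 x*y≈0⇒y≈0 (pochhammerCoeff ρ) (pochhammerRoot ρ)
                 (pochhammerCoeff*root≈1 ρ) (pochhammerCoeff*root≉1 ρ) ρ (Π A n p)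
      complement : ∀ {i} → i ℕ.< ρ → suc (ρ ∸ suc i) ℕ.+ i ≡ ρ
      complement {i} i<ρ = ≡.trans (≡.sym (ℕ.+-suc (ρ ∸ suc i) i)) (ℕ.m∸n+n≡m i<ρ)

module ℚ⟮q⟯-Laurent where
  open CommutativeRing ℚ⟮q⟯-commutativeRing using (semiring; setoid; refl; reflexive; +-cong; +-identityˡ; -‿inverseˡ; zeroʳ)
  open Algebra.Definitions.RawSemiring (Semiring.rawSemiring semiring) using (_^_; sum)
  open ℚ⟮q⟯-Field using (invF-inverseˡ; q^F-injective)

  ^F≡^ : ∀ x m → x ^F m ≡ x ^ m
  ^F≡^ x zero    = ≡.refl
  ^F≡^ x (suc m) = ≡.cong (x *F_) (^F≡^ x m)

  ∑F≈sum : ∀ {m} (f g : Fin m → ℚ⟮q⟯) → (∀ i → f i ≈F g i) → ∑F f ≈F sum g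
  ∑F≈sum {zero}  f g f≈g = refl {0F}
  ∑F≈sum {suc m} f g f≈g =
    +-cong {f fzero} {g fzero} {∑F (f ∘ fsuc)} {sum (g ∘ fsuc)} (f≈g fzero) (∑F≈sum (f ∘ fsuc) (g ∘ fsuc) (f≈g ∘ fsuc))

  q^-injective : ∀ a b → (qF ^ a) ≈F (qF ^ b) → a ≡ b
  q^-injective a b qᵃ≈qᵇ = q^F-injective a b (≡.subst₂ _≈F_ (≡.sym (^F≡^ qF a)) (≡.sym (^F≡^ qF b)) qᵃ≈qᵇ)

  open LaurentCriterion.Field ℚ⟮q⟯-commutativeRing invF invF-inverseˡ qF q^-injective public
  open Polynomial ℚ⟮q⟯-commutativeRing
    using (Poly; _≃_; _∣_; _⊗_; ≃-refl; ≃-sym; ≃-trans; ≃-reflexive; ∑-cong; ∏-cong; ⊗-cong; ^ₚ-congˡ; 1-[_]X; linearFactors; ∣ₚ⇔∣; ∣-resp-≃)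

  lin≃1-[q^t]X : ∀ t → lin t ≃ 1-[ qF ^ t ]X
  lin≃1-[q^t]X t = ≃-reflexive (≡.cong 1-[_]X (^F≡^ qF t))

  Πpoly≃Π : ∀ A n p → Πpoly A n p ≃ Π A n p
  Πpoly≃Π A n p = ∑-cong λ j → ∑-cong λ t →
    ⊗-cong (≃-reflexive (≡.cong (λ c → Cs (c *F p j t)) (^F≡^ qF (toℕ t))))
           (∏-cong λ i → ^ₚ-congˡ (exponent A j t i) (lin≃1-[q^t]X (toℕ i)))

  qPoch-suc : ∀ a m → qPoch a (suc m) ≡ (qPoch a m ⊗ 1-[ a *F (qF ^F m) ]X)
  qPoch-suc a m = ≡.refl

  qPoch≃linearFactors : ∀ ρ m → qPoch (invF qF ^F ρ) m ≃ linearFactors (pochhammerCoeff ρ) m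
  qPoch≃linearFactors ρ zero    = ≃-refl
  qPoch≃linearFactors ρ (suc m) = ≃-trans (≃-reflexive (qPoch-suc (invF qF ^F ρ) m))
    (⊗-cong (qPoch≃linearFactors ρ m) (≃-reflexive (≡.cong 1-[_]X coeff≡)))
    where
    coeff≡ : (invF qF ^F ρ) *F (qF ^F m) ≡ pochhammerCoeff ρ m
    coeff≡ = ≡.cong₂ _*F_ (^F≡^ (invF qF) ρ) (^F≡^ qF m)

  qPoch∣Πpoly⇔pochhammer∣Π : ∀ A n p ρ → qPoch (invF qF ^F ρ) ρ ∣s Πpoly A n p ⇔ linearFactors (pochhammerCoeff ρ) ρ ∣ Π A n p
  qPoch∣Πpoly⇔pochhammer∣Π A n p ρ = mk⇔
    (λ ∣s → ∣-resp-≃ (qPoch≃linearFactors ρ ρ) (Πpoly≃Π A n p) (Equivalence.to ∣ₚ⇔∣ ∣s))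
    (λ ∣Π → Equivalence.from ∣ₚ⇔∣ (∣-resp-≃ (≃-sym (qPoch≃linearFactors ρ ρ)) (≃-sym (Πpoly≃Π A n p)) ∣Π))

  liCoeff≡li : ∀ J m → liCoeff J (+ suc m) ≡ li J (suc m)
  liCoeff≡li J m = ≡.cong₂ (λ a b → a *F invF b) (^F≡^ qF (suc m))
    (≡.trans (^F≡^ (1F +F (-F (qF ^F suc m))) J) (≡.cong (λ a → (1F +F (-F a)) ^ J) (^F≡^ qF (suc m))))

  laurentCoeff-negative : ∀ {A n} p0 (p : Fin A → Fin (suc n) → ℚ⟮q⟯) k →
                          laurentCoeff p0 p ℤ.-[1+ k ] ≈F negCoeff A n p k
  laurentCoeff-negative {A} {n} p0 p k = begin
    0F +F ∑F (λ j → ∑F (term j))   ≈⟨ +-identityˡ (∑F (λ j → ∑F (term j))) ⟩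
    ∑F (λ j → ∑F (term j))         ≈⟨ ∑F≈sum (λ j → ∑F (term j)) (λ j → sum (summand j)) (λ j →
                                         ∑F≈sum (term j) (summand j) λ t → reflexive (≡.cong (p j t *F_) (liCoeff≡li′ j t))) ⟩
    negCoeff A n p k               ∎
    where
    open Relation.Binary.Reasoning.Setoid setoid
    liCoeff≡li′ : ∀ j t → liCoeff (suc (toℕ j)) ((+ toℕ t) ℤ.- ℤ.-[1+ k ]) ≡ li (suc (toℕ j)) (suc (toℕ t ℕ.+ k))
    liCoeff≡li′ j t = ≡.trans (≡.cong (λ e → liCoeff (suc (toℕ j)) (+ e)) (ℕ.+-suc (toℕ t) k))
                              (liCoeff≡li (suc (toℕ j)) (toℕ t ℕ.+ k))
    term summand : Fin A → Fin (suc n) → ℚ⟮q⟯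
    term j t = p j t *F liCoeff (suc (toℕ j)) ((+ toℕ t) ℤ.- ℤ.-[1+ k ])
    summand j t = p j t *F li (suc (toℕ j)) (suc (toℕ t ℕ.+ k))

  liCoeff-nonnegative : ∀ J {t m} → t ℕ.< m → liCoeff J ((+ t) ℤ.- (+ m)) ≡ 0F
  liCoeff-nonnegative J {t} {suc m} t<m = ≡.trans (≡.cong (liCoeff J) (ℤ.⊖-< t<m)) (liCoeff-nonpositive (suc m ∸ t))
    where
    liCoeff-nonpositive : ∀ d → liCoeff J (ℤ.- (+ d)) ≡ 0F
    liCoeff-nonpositive zero    = ≡.refl
    liCoeff-nonpositive (suc d) = ≡.refl

  liPart : ∀ {A n} → (Fin A → Fin (suc n) → ℚ⟮q⟯) → ℕ → ℚ⟮q⟯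
  liPart {A} {n} p m = ∑F λ j → ∑F λ t → p j t *F liCoeff (suc (toℕ j)) ((+ toℕ t) ℤ.- (+ m))

  liPart≈0 : ∀ {A n} (p : Fin A → Fin (suc n) → ℚ⟮q⟯) {m} → n ℕ.< m → liPart p m ≈F 0F
  liPart≈0 {A} {n} p {m} n<m = begin
    liPart p m               ≈⟨ ∑F≈sum _ (λ _ → 0F) (λ j → begin
      ∑F (term j)                ≈⟨ ∑F≈sum (term j) (λ _ → 0F) (λ t → begin
        term j t                     ≡⟨ ≡.cong (p j t *F_) (liCoeff-nonnegative _ (ℕ.<-≤-trans (toℕ<n t) n<m)) ⟩
        p j t *F 0F                  ≈⟨ zeroʳ (p j t) ⟩
        0F                           ∎) ⟩
      sum (λ (_ : Fin (suc n)) → 0F) ≈⟨ sum-replicate-zero (suc n) ⟩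
      0F                           ∎) ⟩
    sum (λ (_ : Fin A) → 0F)  ≈⟨ sum-replicate-zero A ⟩
    0F                        ∎
    where
    open Relation.Binary.Reasoning.Setoid setoid
    open import Algebra.Properties.Semiring.Sum semiring using (sum-replicate-zero)
    term : Fin A → Fin (suc n) → ℚ⟮q⟯
    term j t = p j t *F liCoeff (suc (toℕ j)) ((+ toℕ t) ℤ.- (+ m))

  coeffAt-< : ∀ {N} (g : ℕ → ℚ⟮q⟯) {m} → m ℕ.< N → coeffAt {N} (g ∘ toℕ) (+ m) ≡ g m
  coeffAt-< {suc N} g {zero}  _              = ≡.refl
  coeffAt-< {suc N} g {suc m} (ℕ.s≤s m<N) = coeffAt-< (g ∘ suc) m<N

  coeffAt-≥ : ∀ {N} (g : ℕ → ℚ⟮q⟯) {m} → N ℕ.≤ m → coeffAt {N} (g ∘ toℕ) (+ m) ≡ 0F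
  coeffAt-≥ {zero}  g         _              = ≡.refl
  coeffAt-≥ {suc N} g {suc m} (ℕ.s≤s N≤m) = coeffAt-≥ (g ∘ suc) N≤m

  -ρ≤-[1+k]⇔k<ρ : ∀ {ρ k} → -ℤ (+ ρ) ≤ℤ ℤ.-[1+ k ] ⇔ k ℕ.< ρ
  -ρ≤-[1+k]⇔k<ρ {zero}  = mk⇔ (λ ()) (λ ())
  -ρ≤-[1+k]⇔k<ρ {suc ρ} = mk⇔ (λ { (ℤ.-≤- k≤ρ) → ℕ.s≤s k≤ρ }) (λ { (ℕ.s≤s k≤ρ) → ℤ.-≤- k≤ρ })

  -- P₀ cancels the contributions of the Li-series to z^0, …, z^n; above z^n there are none.
  P₀ : ∀ {A n} → (Fin A → Fin (suc n) → ℚ⟮q⟯) → Fin (suc n) → ℚ⟮q⟯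
  P₀ p t = -F liPart p (toℕ t)

  laurentCoeff-P₀-nonnegative : ∀ {A n} (p : Fin A → Fin (suc n) → ℚ⟮q⟯) m → laurentCoeff (P₀ p) p (+ m) ≈F 0F
  laurentCoeff-P₀-nonnegative {n = n} p m = byCases (m ℕ.<? suc n)
    where
    open Relation.Binary.Reasoning.Setoid setoid
    byCases : Dec (m ℕ.< suc n) → laurentCoeff (P₀ p) p (+ m) ≈F 0F
    byCases (yes m≤n) = begin
      coeffAt (P₀ p) (+ m) +F liPart p m  ≡⟨ ≡.cong (_+F liPart p m) (coeffAt-< (λ m → -F liPart p m) m≤n) ⟩
      (-F liPart p m) +F liPart p m       ≈⟨ -‿inverseˡ (liPart p m) ⟩
      0F                                  ∎
    byCases (no m≰n) = begin
      coeffAt (P₀ p) (+ m) +F liPart p m  ≡⟨ ≡.cong (_+F liPart p m) (coeffAt-≥ (λ m → -F liPart p m) (ℕ.≮⇒≥ m≰n)) ⟩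
      0F +F liPart p m                    ≈⟨ +-identityˡ (liPart p m) ⟩
      liPart p m                          ≈⟨ liPart≈0 p (ℕ.≮⇒≥ m≰n) ⟩
      0F                                  ∎

  P₀-exists⇔negCoeff≈0 : ∀ A n ρ (p : Fin A → Fin (suc n) → ℚ⟮q⟯) →
    Σ (Fin (suc n) → ℚ⟮q⟯) (λ p0 → (e : ℤ) → -ℤ (+ ρ) ≤ℤ e → laurentCoeff p0 p e ≈F 0F)
    ⇔ (∀ {k} → k ℕ.< ρ → negCoeff A n p k ≈F 0F)
  P₀-exists⇔negCoeff≈0 A n ρ p = mk⇔
    (λ (p0 , vanish) {k} k<ρ → begin
      negCoeff A n p k              ≈⟨ laurentCoeff-negative p0 p k ⟨
      laurentCoeff p0 p ℤ.-[1+ k ]  ≈⟨ vanish ℤ.-[1+ k ] (Equivalence.from -ρ≤-[1+k]⇔k<ρ k<ρ) ⟩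
      0F                            ∎)
    (λ negCoeff≈0 → P₀ p , vanish (λ {k} → negCoeff≈0 {k}))
    where
    open Relation.Binary.Reasoning.Setoid setoid
    vanish : (∀ {k} → k ℕ.< ρ → negCoeff A n p k ≈F 0F) → (e : ℤ) → -ℤ (+ ρ) ≤ℤ e → laurentCoeff (P₀ p) p e ≈F 0F
    vanish _          (+ m)       _          = laurentCoeff-P₀-nonnegative p m
    vanish negCoeff≈0 ℤ.-[1+ k ] -ρ≤-[1+k] = begin
      laurentCoeff (P₀ p) p ℤ.-[1+ k ]  ≈⟨ laurentCoeff-negative (P₀ p) p k ⟩
      negCoeff A n p k                  ≈⟨ negCoeff≈0 (Equivalence.to -ρ≤-[1+k]⇔k<ρ -ρ≤-[1+k]) ⟩
      0F                                ∎

open ℚ⟮q⟯-Laurent using (P₀-exists⇔negCoeff≈0; pochhammer∣Π⇔negCoeff≈0; qPoch∣Πpoly⇔pochhammer∣Π)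

lemma1 : (A n ρ : ℕ) → 1 ≤ A → (p : Fin A → Fin (suc n) → ℚ⟮q⟯) →
    (Σ (Fin (suc n) → ℚ⟮q⟯) (λ p0 → (e : ℤ) → -ℤ (+ ρ) ≤ℤ e → laurentCoeff p0 p e ≈F 0F))
    ⇔ (qPoch (invF qF ^F ρ) ρ ∣s Πpoly A n p)
lemma1 A n ρ _ p =
  ⇔-sym (qPoch∣Πpoly⇔pochhammer∣Π A n p ρ) ⇔-∘ (⇔-sym (pochhammer∣Π⇔negCoeff≈0 A n p ρ) ⇔-∘ P₀-exists⇔negCoeff≈0 A n ρ p)
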